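{- Let $p$ be a prime, $m\in\{1,\ldots,p-1\}$, $d\ge0$ an integer, and $n=mp^d$. Then for every $i\in\mathbb{Z}_p$, \[ c_{p,i}(n)=\begin{cases} 2^{\,n-m}\,|\{\gamma\models m: r_\gamma\equiv i\pmod p\}| & \text{if } i=0 \text{ or } p=2 \text{ or } d=0,\\ 2^{\,n-m-1}\,|\{\gamma\models m: r_\gamma\equiv\pm i\pmod p\}| & \text{otherwise}.\end{cases} \]
   Context: For a permutation $w$ of $[n]$, $D(w)=\{i\in[n-1]: w(i)>w(i+1)\}$. A composition $\alpha\models n$ is a sequence $(\alpha_1,\ldots,\alpha_\ell)$ of positive integers with sum $n$; $D(\alpha)=\{\alpha_1,\alpha_1+\alpha_2,\ldots,\alpha_1+\cdots+\alpha_{\ell-1}\}$. The ribbon number is $r_\alpha=|\{w\in\mathfrak{S}_n: D(w)=D(\alpha)\}|$, and $c_{p,i}(n)=|\{\alpha\models n: r_\alpha\equiv i\pmod p\}|$. "$\equiv\pm i$" means $\equiv i$ or $\equiv -i$ mod $p$. -}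

module Defs where

open import Data.Nat using (ℕ; zero; suc; _+_; _∸_; _<ᵇ_; _%_; NonZero)
open import Data.Nat.Properties using (_≟_)
open import Data.Bool using (Bool; true; false; if_then_else_)
open import Data.List using (List; []; _∷_; _++_; map; concatMap; length; filter)
open import Data.Nat.ListAction using (sum)
open import Data.List.Properties using (≡-dec)
open import Relation.Binary.PropositionalEquality using (_≡_)
open import Relation.Nullary.Decidable using (_⊎-dec_)

-- We use the values 0,…,n-1 (one-line notation shifted by one), which has
-- no effect on descent sets.
-- insertAll x ys: all lists obtained by inserting x at some position of ys
insertAll : ℕ → List ℕ → List (List ℕ)
insertAll x [] = (x ∷ []) ∷ []
insertAll x (y ∷ ys) = (x ∷ y ∷ ys) ∷ map (y ∷_) (insertAll x ys)

perms : ℕ → List (List ℕ)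
perms zero = [] ∷ []
perms (suc n) = concatMap (insertAll n) (perms n)

-- Descent set D(w) = { i ∈ [n-1] : w(i) > w(i+1) }, positions 1-based,
-- listed in increasing order.  descentsFrom k w: descents of w whose
-- first entry sits at position k.
descentsFrom : ℕ → List ℕ → List ℕ
descentsFrom k [] = []
descentsFrom k (a ∷ []) = []
descentsFrom k (a ∷ b ∷ w) =
  if b <ᵇ a then k ∷ descentsFrom (suc k) (b ∷ w) else descentsFrom (suc k) (b ∷ w)

descents : List ℕ → List ℕ
descents w = descentsFrom 1 w

-- Compositions of n: lists of positive integers with sum n.
incrFirst : List ℕ → List ℕ
incrFirst [] = []
incrFirst (a ∷ as) = suc a ∷ as

compositions : ℕ → List (List ℕ)
compositions zero = [] ∷ []
compositions (suc zero) = (1 ∷ []) ∷ []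
compositions (suc (suc n)) =
  map (1 ∷_) (compositions (suc n)) ++ map incrFirst (compositions (suc n))

partialSums : ℕ → List ℕ → List ℕ
partialSums s [] = []
partialSums s (a ∷ []) = []
partialSums s (a ∷ b ∷ as) = (s + a) ∷ partialSums (s + a) (b ∷ as)

descentSetOfComp : List ℕ → List ℕ
descentSetOfComp α = partialSums 0 α

ribbon : List ℕ → ℕ
ribbon α = length (filter (λ w → ≡-dec _≟_ (descents w) (descentSetOfComp α)) (perms (sum α)))

c : (p : ℕ) .{{_ : NonZero p}} → ℕ → ℕ → ℕ
c p i n = length (filter (λ α → ribbon α % p ≟ i) (compositions n))

cPM : (p : ℕ) .{{_ : NonZero p}} → ℕ → ℕ → ℕ
cPM p i m = length (filter (λ γ → (ribbon γ % p ≟ i) ⊎-dec (ribbon γ % p ≟ (p ∸ i) % p)) (compositions m))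

module Submission where

-- A composition of n is encoded by its descent set, a bit list of length n - 1.  The number
-- of permutations whose descent set lies within b is the multinomial coefficient of the
-- blocks of b, and ribbon numbers are recovered from these by Möbius inversion over subsets,
-- which is unitriangular and hence invertible modulo p.  For n = m q with q = p ^ d,
-- Lucas-type congruences make the multinomial of b vanish modulo p unless all descents of b
-- are multiples of q, in which case it is the multinomial of the coarsened descent set.
-- Inverting, r_α ≡ ± r_γ (mod p), where γ ⊨ m is the coarsening of α and the sign is the
-- parity of the descents of α off the multiples of q.  Each γ arises from 2 ^ (n - m)
-- compositions α, half of each sign when d ≥ 1, and counting residues gives both cases.

open import Defs
open import Data.Nat using (ℕ; zero; suc; _*_; _∸_; _^_; _≤_; _<_; NonZero)
open import Data.Nat.Primality using (Prime)
open import Data.Product using (_×_)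
open import Data.Sum using (_⊎_)
open import Relation.Binary.PropositionalEquality using (_≡_)
open import Relation.Nullary using (¬_)

open import Data.Bool using (Bool; true; false; if_then_else_; _∧_; not; _xor_)
open import Data.Bool.Properties using (T-≡; not-involutive)
open import Data.Empty using (⊥; ⊥-elim)
open import Data.List using (List; []; _∷_; _++_; map; concatMap; length; filter)
open import Data.List.Properties using (∷-injectiveʳ; map-++; map-∘; map-cong; map-cong-local; ≡-dec; filter-≐)
open import Data.List.Relation.Unary.All as All using (All; []; _∷_)
open import Data.List.Relation.Unary.All.Properties using (++⁺; map⁺; concat⁺)
open import Data.Nat using (_+_; _%_; _/_; _<ᵇ_; s≤s; z<s; pred)
open import Data.Nat.Base using (nonTrivial⇒n>1; >-nonZero)
open import Data.Nat.Combinatorics using (_C_; nCk+nC[k+1]≡[n+1]C[k+1]; k>n⇒nCk≡0; nCn≡1; nC1≡n; nCk≡nC[n∸k])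
open import Data.Nat.Divisibility using (divides; n∣m⇒m%n≡0; m%n≡0⇒n∣m; ∣⇒≤)
open import Data.Nat.DivMod
  using (%-distribˡ-+; %-distribˡ-*; m*n%n≡0; [m+kn]%n≡m%n; m≡m%n+[m/n]*n; m%n<n; m<n*o⇒m/o<n; m<n⇒m%n≡m; n%n≡0)
open import Data.Nat.ListAction using (sum)
open import Data.Nat.ListAction.Properties using (sum-++)
open import Data.Nat.Primality using (euclidsLemma; prime⇒nonTrivial)
open import Data.Nat.Properties
open import Data.Nat.Tactic.RingSolver using (solve-∀)
open import Data.Product using (_,_)
open import Data.Sum using (inj₁; inj₂)
open import Function using (_∘_; Equivalence)
open import Function.Bundles using (_⇔_; mk⇔)
open import Relation.Binary.Bundles using (Setoid)
open import Relation.Binary.PropositionalEquality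
  using (_≢_; refl; sym; trans; cong; cong₂; subst; module ≡-Reasoning)
import Relation.Binary.Reasoning.Setoid
open import Relation.Binary.Structures using (IsEquivalence)
open import Relation.Nullary using (Dec; does; yes; no)
open import Relation.Nullary.Decidable using (dec-true; dec-false; _⊎-dec_)

pascal : ∀ n k → suc n C suc k ≡ n C k + n C suc k
pascal n k = sym (nCk+nC[k+1]≡[n+1]C[k+1] n k)

[1+n]C[1+k]*[1+k]≡[1+n]*nCk : ∀ n k → (suc n C suc k) * suc k ≡ suc n * (n C k)
[1+n]C[1+k]*[1+k]≡[1+n]*nCk zero    zero    = refl
[1+n]C[1+k]*[1+k]≡[1+n]*nCk zero    (suc k) = refl
[1+n]C[1+k]*[1+k]≡[1+n]*nCk (suc n) zero    = cong (_* 1) (nC1≡n (suc (suc n)))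
[1+n]C[1+k]*[1+k]≡[1+n]*nCk (suc n) (suc k) = begin
  (suc (suc n) C suc (suc k)) * suc (suc k)
    ≡⟨ cong (_* suc (suc k)) (pascal (suc n) (suc k)) ⟩
  (A + B) * suc (suc k)
    ≡⟨ shuffle A B (suc k) ⟩
  A * suc k + A + B * suc (suc k)
    ≡⟨ cong₂ (λ x y → x + A + y) ([1+n]C[1+k]*[1+k]≡[1+n]*nCk n k) ([1+n]C[1+k]*[1+k]≡[1+n]*nCk n (suc k)) ⟩
  suc n * (n C k) + A + suc n * (n C suc k)
    ≡⟨ regroup (suc n) (n C k) A (n C suc k) ⟩
  A + suc n * (n C k + n C suc k)
    ≡⟨ cong (λ x → A + suc n * x) (pascal n k) ⟨
  suc (suc n) * A
    ∎
  where
  open ≡-Reasoning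
  A B : ℕ
  A = suc n C suc k
  B = suc n C suc (suc k)
  shuffle : ∀ a b k → (a + b) * suc k ≡ a * k + a + b * suc k
  shuffle = solve-∀
  regroup : ∀ m x a y → m * x + a + m * y ≡ a + m * (x + y)
  regroup = solve-∀

[n+1]Cn≡1+n : ∀ n → (n + 1) C n ≡ suc n
[n+1]Cn≡1+n n = begin
  (n + 1) C n            ≡⟨ nCk≡nC[n∸k] (m≤m+n n 1) ⟩
  (n + 1) C (n + 1 ∸ n)  ≡⟨ cong ((n + 1) C_) (m+n∸m≡n n 1) ⟩
  (n + 1) C 1            ≡⟨ nC1≡n (n + 1) ⟩
  n + 1                  ≡⟨ +-comm n 1 ⟩
  suc n                  ∎
  where open ≡-Reasoning

𝟙 : Bool → ℕ
𝟙 true  = 1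
𝟙 false = 0

private
  variable
    A B : Set

∑ : (A → ℕ) → List A → ℕ
∑ f xs = sum (map f xs)

∑-++ : ∀ (f : A → ℕ) xs ys → ∑ f (xs ++ ys) ≡ ∑ f xs + ∑ f ys
∑-++ f xs ys = trans (cong sum (map-++ f xs ys)) (sum-++ (map f xs) (map f ys))

∑-map : ∀ (f : B → ℕ) (g : A → B) xs → ∑ f (map g xs) ≡ ∑ (f ∘ g) xs
∑-map f g xs = cong sum (sym (map-∘ xs))

∑-cong : ∀ {f g : A → ℕ} xs → (∀ x → f x ≡ g x) → ∑ f xs ≡ ∑ g xs
∑-cong xs f≗g = cong sum (map-cong f≗g xs)

∑-cong-All : ∀ {f g : A → ℕ} {xs} → All (λ x → f x ≡ g x) xs → ∑ f xs ≡ ∑ g xs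
∑-cong-All = cong sum ∘ map-cong-local

∑-concatMap : ∀ (f : B → ℕ) (g : A → List B) xs → ∑ f (concatMap g xs) ≡ ∑ (∑ f ∘ g) xs
∑-concatMap f g []       = refl
∑-concatMap f g (x ∷ xs) = trans (∑-++ f (g x) (concatMap g xs)) (cong (∑ f (g x) +_) (∑-concatMap f g xs))

∑-0 : ∀ (xs : List A) → ∑ (λ _ → 0) xs ≡ 0
∑-0 []       = refl
∑-0 (_ ∷ xs) = ∑-0 xs

∑-+ : ∀ (f g : A → ℕ) xs → ∑ (λ x → f x + g x) xs ≡ ∑ f xs + ∑ g xs
∑-+ f g []       = refl
∑-+ f g (x ∷ xs) = trans (cong (f x + g x +_) (∑-+ f g xs)) (interchange (f x) (g x) (∑ f xs) (∑ g xs))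
  where
  interchange : ∀ a b c d → a + b + (c + d) ≡ a + c + (b + d)
  interchange = solve-∀

∑-*ˡ : ∀ c (f : A → ℕ) xs → ∑ (λ x → c * f x) xs ≡ c * ∑ f xs
∑-*ˡ c f []       = sym (*-zeroʳ c)
∑-*ˡ c f (x ∷ xs) = trans (cong (c * f x +_) (∑-*ˡ c f xs)) (sym (*-distribˡ-+ c (f x) (∑ f xs)))

∑-comm : ∀ (h : A → B → ℕ) xs ys → ∑ (λ x → ∑ (h x) ys) xs ≡ ∑ (λ y → ∑ (λ x → h x y) xs) ys
∑-comm h []       ys = sym (∑-0 ys)
∑-comm h (x ∷ xs) ys = trans (cong (∑ (h x) ys +_) (∑-comm h xs ys)) (sym (∑-+ (h x) _ ys))

length-filter≡∑𝟙 : ∀ {P : A → Set} (P? : ∀ x → Dec (P x)) xs → length (filter P? xs) ≡ ∑ (𝟙 ∘ does ∘ P?) xs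
length-filter≡∑𝟙 P? []       = refl
length-filter≡∑𝟙 P? (x ∷ xs) with does (P? x)
... | true  = cong suc (length-filter≡∑𝟙 P? xs)
... | false = length-filter≡∑𝟙 P? xs

length-filter-⊎ : ∀ {P Q : A → Set} (P? : ∀ x → Dec (P x)) (Q? : ∀ x → Dec (Q x)) →
  (∀ {x} → P x → Q x → ⊥) → ∀ xs →
  length (filter P? xs) + length (filter Q? xs) ≡ length (filter (λ x → P? x ⊎-dec Q? x) xs)
length-filter-⊎ P? Q? disjoint []       = refl
length-filter-⊎ P? Q? disjoint (x ∷ xs) with P? x | Q? x
... | yes Px | yes Qx = ⊥-elim (disjoint Px Qx)
... | yes _  | no  _  = cong suc (length-filter-⊎ P? Q? disjoint xs)
... | no  _  | yes _  = trans (+-suc _ _) (cong suc (length-filter-⊎ P? Q? disjoint xs))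
... | no  _  | no  _  = length-filter-⊎ P? Q? disjoint xs

<⇒<ᵇ≡true : ∀ {m n} → m < n → (m <ᵇ n) ≡ true
<⇒<ᵇ≡true = Equivalence.to T-≡ ∘ <⇒<ᵇ

≥⇒<ᵇ≡false : ∀ {m n} → n ≤ m → (m <ᵇ n) ≡ false
≥⇒<ᵇ≡false {m}     {zero}  _         = refl
≥⇒<ᵇ≡false {suc m} {suc n} (s≤s n≤m) = ≥⇒<ᵇ≡false n≤m

-- A subset of {1, …, L} is encoded as a bit list of length L, bit j standing for j + 1.
descentBits : List ℕ → List Bool
descentBits []          = []
descentBits (a ∷ [])    = []
descentBits (a ∷ b ∷ w) = (b <ᵇ a) ∷ descentBits (b ∷ w)

infix 4 _⊆ᵇ_ _==_

_⊆ᵇ_ : List Bool → List Bool → Bool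
[]          ⊆ᵇ []      = true
[]          ⊆ᵇ (_ ∷ _) = false
(_ ∷ _)     ⊆ᵇ []      = false
(false ∷ u) ⊆ᵇ (_ ∷ v) = u ⊆ᵇ v
(true ∷ u)  ⊆ᵇ (y ∷ v) = y ∧ (u ⊆ᵇ v)

_==_ : List Bool → List Bool → Bool
[]          == []          = true
[]          == (_ ∷ _)     = false
(_ ∷ _)     == []          = false
(false ∷ u) == (false ∷ v) = u == v
(false ∷ u) == (true ∷ v)  = false
(true ∷ u)  == (false ∷ v) = false
(true ∷ u)  == (true ∷ v)  = u == v

length-descentBits : ∀ L w → length w ≡ suc L → length (descentBits w) ≡ L
length-descentBits zero    (a ∷ [])    _ = refl
length-descentBits (suc L) (a ∷ b ∷ w) e = cong suc (length-descentBits L (b ∷ w) (suc-injective e))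

maxInsertionsAfterHead : List Bool → List (List Bool)
maxInsertionsAfterHead []      = (false ∷ []) ∷ []
maxInsertionsAfterHead (c ∷ u) = (false ∷ true ∷ u) ∷ map (c ∷_) (maxInsertionsAfterHead u)

maxInsertions : List Bool → List (List Bool)
maxInsertions u = (true ∷ u) ∷ maxInsertionsAfterHead u

descentBits-insertAll-afterHead : ∀ x y w → All (_< x) (y ∷ w) →
  map (descentBits ∘ (y ∷_)) (insertAll x w) ≡ maxInsertionsAfterHead (descentBits (y ∷ w))
descentBits-insertAll-afterHead x y [] (y<x ∷ []) rewrite ≥⇒<ᵇ≡false (<⇒≤ y<x) = refl
descentBits-insertAll-afterHead x y (z ∷ w) (y<x ∷ z<x ∷ w<x)
  rewrite ≥⇒<ᵇ≡false (<⇒≤ y<x) | <⇒<ᵇ≡true z<x = cong ((false ∷ true ∷ descentBits (z ∷ w)) ∷_) (begin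
    map (descentBits ∘ (y ∷_)) (map (z ∷_) (insertAll x w))
      ≡⟨ map-∘ (insertAll x w) ⟨
    map (((z <ᵇ y) ∷_) ∘ descentBits ∘ (z ∷_)) (insertAll x w)
      ≡⟨ map-∘ (insertAll x w) ⟩
    map ((z <ᵇ y) ∷_) (map (descentBits ∘ (z ∷_)) (insertAll x w))
      ≡⟨ cong (map ((z <ᵇ y) ∷_)) (descentBits-insertAll-afterHead x z w (z<x ∷ w<x)) ⟩
    map ((z <ᵇ y) ∷_) (maxInsertionsAfterHead (descentBits (z ∷ w)))
      ∎)
  where open ≡-Reasoning

descentBits-insertAll : ∀ x y w → All (_< x) (y ∷ w) →
  map descentBits (insertAll x (y ∷ w)) ≡ maxInsertions (descentBits (y ∷ w))
descentBits-insertAll x y w (y<x ∷ w<x) rewrite <⇒<ᵇ≡true y<x =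
  cong ((true ∷ descentBits (y ∷ w)) ∷_)
       (trans (sym (map-∘ (insertAll x w))) (descentBits-insertAll-afterHead x y w (y<x ∷ w<x)))

-- removeMaxBounds b lists, for each position the maximum may take in a permutation with
-- descents within b, the bound this leaves on the remaining permutation.
removeMaxBoundsAfterHead : List Bool → List (List Bool)
removeMaxBoundsAfterHead []            = []
removeMaxBoundsAfterHead (b₀ ∷ [])     = [] ∷ []
removeMaxBoundsAfterHead (b₀ ∷ b₁ ∷ b) =
  (if b₁ then (true ∷ b) ∷ [] else []) ++ map (b₀ ∷_) (removeMaxBoundsAfterHead (b₁ ∷ b))

removeMaxBounds : List Bool → List (List Bool)
removeMaxBounds []      = []
removeMaxBounds (b₀ ∷ b) = (if b₀ then b ∷ [] else []) ++ removeMaxBoundsAfterHead (b₀ ∷ b)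

∑-maxInsertionsAfterHead-⊆ᵇ : ∀ u b → length b ≡ suc (length u) →
  ∑ (λ v → 𝟙 (v ⊆ᵇ b)) (maxInsertionsAfterHead u) ≡ ∑ (λ q → 𝟙 (u ⊆ᵇ q)) (removeMaxBoundsAfterHead b)
∑-maxInsertionsAfterHead-⊆ᵇ []      (b₀ ∷ [])     _ = refl
∑-maxInsertionsAfterHead-⊆ᵇ (c ∷ u) (b₀ ∷ b₁ ∷ b) e = begin
  𝟙 (b₁ ∧ (u ⊆ᵇ b)) + ∑ (λ v → 𝟙 (v ⊆ᵇ b₀ ∷ b₁ ∷ b)) (map (c ∷_) (maxInsertionsAfterHead u))
    ≡⟨ cong₂ _+_ (head-bound c b₁) (∑-map _ (c ∷_) (maxInsertionsAfterHead u)) ⟩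
  ∑ (λ q → 𝟙 (c ∷ u ⊆ᵇ q)) (if b₁ then (true ∷ b) ∷ [] else [])
    + ∑ (λ v → 𝟙 (c ∷ v ⊆ᵇ b₀ ∷ b₁ ∷ b)) (maxInsertionsAfterHead u)
    ≡⟨ cong (_ +_) (tail-bounds c b₀) ⟩
  ∑ (λ q → 𝟙 (c ∷ u ⊆ᵇ q)) (if b₁ then (true ∷ b) ∷ [] else [])
    + ∑ (λ q → 𝟙 (c ∷ u ⊆ᵇ b₀ ∷ q)) (removeMaxBoundsAfterHead (b₁ ∷ b))
    ≡⟨ cong₂ _+_ refl (∑-map _ (b₀ ∷_) (removeMaxBoundsAfterHead (b₁ ∷ b))) ⟨
  ∑ (λ q → 𝟙 (c ∷ u ⊆ᵇ q)) (if b₁ then (true ∷ b) ∷ [] else [])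
    + ∑ (λ q → 𝟙 (c ∷ u ⊆ᵇ q)) (map (b₀ ∷_) (removeMaxBoundsAfterHead (b₁ ∷ b)))
    ≡⟨ ∑-++ _ (if b₁ then (true ∷ b) ∷ [] else []) _ ⟨
  ∑ (λ q → 𝟙 (c ∷ u ⊆ᵇ q)) (removeMaxBoundsAfterHead (b₀ ∷ b₁ ∷ b))
    ∎
  where
  open ≡-Reasoning
  IH : ∑ (λ v → 𝟙 (v ⊆ᵇ b₁ ∷ b)) (maxInsertionsAfterHead u) ≡ ∑ (λ q → 𝟙 (u ⊆ᵇ q)) (removeMaxBoundsAfterHead (b₁ ∷ b))
  IH = ∑-maxInsertionsAfterHead-⊆ᵇ u (b₁ ∷ b) (suc-injective e)
  head-bound : ∀ c b₁ → 𝟙 (b₁ ∧ (u ⊆ᵇ b)) ≡ ∑ (λ q → 𝟙 (c ∷ u ⊆ᵇ q)) (if b₁ then (true ∷ b) ∷ [] else [])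
  head-bound c     false = refl
  head-bound false true  = sym (+-identityʳ _)
  head-bound true  true  = sym (+-identityʳ _)
  tail-bounds : ∀ c b₀ → ∑ (λ v → 𝟙 (c ∷ v ⊆ᵇ b₀ ∷ b₁ ∷ b)) (maxInsertionsAfterHead u)
                       ≡ ∑ (λ q → 𝟙 (c ∷ u ⊆ᵇ b₀ ∷ q)) (removeMaxBoundsAfterHead (b₁ ∷ b))
  tail-bounds false b₀    = IH
  tail-bounds true  true  = IH
  tail-bounds true  false = trans (∑-0 (maxInsertionsAfterHead u)) (sym (∑-0 (removeMaxBoundsAfterHead (b₁ ∷ b))))

∑-maxInsertions-⊆ᵇ : ∀ u b → length b ≡ suc (length u) →
  ∑ (λ v → 𝟙 (v ⊆ᵇ b)) (maxInsertions u) ≡ ∑ (λ q → 𝟙 (u ⊆ᵇ q)) (removeMaxBounds b)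
∑-maxInsertions-⊆ᵇ u (b₀ ∷ b) e =
  trans (cong₂ _+_ (head-bound b₀) (∑-maxInsertionsAfterHead-⊆ᵇ u (b₀ ∷ b) e))
        (sym (∑-++ _ (if b₀ then b ∷ [] else []) (removeMaxBoundsAfterHead (b₀ ∷ b))))
  where
  head-bound : ∀ b₀ → 𝟙 (b₀ ∧ (u ⊆ᵇ b)) ≡ ∑ (λ q → 𝟙 (u ⊆ᵇ q)) (if b₀ then b ∷ [] else [])
  head-bound false = refl
  head-bound true  = sym (+-identityʳ _)

removeMaxBoundsAfterHead-length : ∀ L b → length b ≡ suc L → All (λ q → length q ≡ L) (removeMaxBoundsAfterHead b)
removeMaxBoundsAfterHead-length L (b₀ ∷ [])     e = suc-injective e ∷ []
removeMaxBoundsAfterHead-length L (b₀ ∷ b₁ ∷ b) e =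
  ++⁺ (head-length b₁) (map⁺ (All.map (λ lq → trans (cong suc lq) (suc-injective e))
                                      (removeMaxBoundsAfterHead-length (length b) (b₁ ∷ b) refl)))
  where
  head-length : ∀ b₁ → All (λ q → length q ≡ L) (if b₁ then (true ∷ b) ∷ [] else [])
  head-length false = []
  head-length true  = suc-injective e ∷ []

removeMaxBounds-length : ∀ L b → length b ≡ suc L → All (λ q → length q ≡ L) (removeMaxBounds b)
removeMaxBounds-length L (b₀ ∷ b) e = ++⁺ (head-length b₀) (removeMaxBoundsAfterHead-length L (b₀ ∷ b) e)
  where
  head-length : ∀ b₀ → All (λ q → length q ≡ L) (if b₀ then b ∷ [] else [])
  head-length false = []
  head-length true  = suc-injective e ∷ []

Word : ℕ → List ℕ → Set
Word n w = length w ≡ n × All (_< n) w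

insertAll-preserves : ∀ {x n} w → x < n → All (_< n) w →
  All (λ v → length v ≡ suc (length w) × All (_< n) v) (insertAll x w)
insertAll-preserves []      x<n []          = (refl , x<n ∷ []) ∷ []
insertAll-preserves (y ∷ w) x<n (y<n ∷ w<n) =
  (refl , x<n ∷ y<n ∷ w<n) ∷ map⁺ (All.map (λ (l , v<n) → cong suc l , y<n ∷ v<n) (insertAll-preserves w x<n w<n))

perms-Word : ∀ n → All (Word n) (perms n)
perms-Word zero    = (refl , []) ∷ []
perms-Word (suc n) = concat⁺ (map⁺ (All.map insert-max (perms-Word n)))
  where
  insert-max : ∀ {w} → Word n w → All (Word (suc n)) (insertAll n w)
  insert-max {w} (l , w<n) =
    All.map (λ (l′ , v<1+n) → trans l′ (cong suc l) , v<1+n)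
            (insertAll-preserves w (n<1+n n) (All.map m<n⇒m<1+n w<n))

countWithin countExactly : ℕ → List Bool → ℕ
countWithin  L b = ∑ (λ w → 𝟙 (descentBits w ⊆ᵇ b)) (perms (suc L))
countExactly L b = ∑ (λ w → 𝟙 (descentBits w == b)) (perms (suc L))

countWithin-suc : ∀ L b → length b ≡ suc L → countWithin (suc L) b ≡ ∑ (countWithin L) (removeMaxBounds b)
countWithin-suc L b e = begin
  ∑ (λ v → 𝟙 (descentBits v ⊆ᵇ b)) (concatMap (insertAll (suc L)) (perms (suc L)))
    ≡⟨ ∑-concatMap _ (insertAll (suc L)) (perms (suc L)) ⟩
  ∑ (λ w → ∑ (λ v → 𝟙 (descentBits v ⊆ᵇ b)) (insertAll (suc L) w)) (perms (suc L))
    ≡⟨ ∑-cong-All (All.map (insert-max _) (perms-Word (suc L))) ⟩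
  ∑ (λ w → ∑ (λ q → 𝟙 (descentBits w ⊆ᵇ q)) (removeMaxBounds b)) (perms (suc L))
    ≡⟨ ∑-comm (λ w q → 𝟙 (descentBits w ⊆ᵇ q)) (perms (suc L)) (removeMaxBounds b) ⟩
  ∑ (countWithin L) (removeMaxBounds b)
    ∎
  where
  open ≡-Reasoning
  insert-max : ∀ w → Word (suc L) w →
    ∑ (λ v → 𝟙 (descentBits v ⊆ᵇ b)) (insertAll (suc L) w) ≡ ∑ (λ q → 𝟙 (descentBits w ⊆ᵇ q)) (removeMaxBounds b)
  insert-max (y ∷ w) (l , y∷w<1+L) = begin
    ∑ (λ v → 𝟙 (descentBits v ⊆ᵇ b)) (insertAll (suc L) (y ∷ w))
      ≡⟨ ∑-map (λ u → 𝟙 (u ⊆ᵇ b)) descentBits (insertAll (suc L) (y ∷ w)) ⟨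
    ∑ (λ u → 𝟙 (u ⊆ᵇ b)) (map descentBits (insertAll (suc L) (y ∷ w)))
      ≡⟨ cong (∑ (λ u → 𝟙 (u ⊆ᵇ b))) (descentBits-insertAll (suc L) y w y∷w<1+L) ⟩
    ∑ (λ u → 𝟙 (u ⊆ᵇ b)) (maxInsertions (descentBits (y ∷ w)))
      ≡⟨ ∑-maxInsertions-⊆ᵇ (descentBits (y ∷ w)) b (trans e (cong suc (sym (length-descentBits L (y ∷ w) l)))) ⟩
    ∑ (λ q → 𝟙 (descentBits (y ∷ w) ⊆ᵇ q)) (removeMaxBounds b)
      ∎

multinomial : List ℕ → ℕ
multinomial []      = 1
multinomial (a ∷ α) = ((a + sum α) C a) * multinomial α

-- blocks 1 b is the composition with descent set b; blocks k b enlarges its first part by k - 1.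
blocks : ℕ → List Bool → List ℕ
blocks k []          = k ∷ []
blocks k (false ∷ b) = blocks (suc k) b
blocks k (true ∷ b)  = k ∷ blocks 1 b

blockMultinomial : List Bool → ℕ
blockMultinomial b = multinomial (blocks 1 b)

sum-blocks : ∀ k b → sum (blocks k b) ≡ k + length b
sum-blocks k []          = refl
sum-blocks k (false ∷ b) = trans (sum-blocks (suc k) b) (sym (+-suc k (length b)))
sum-blocks k (true ∷ b)  = cong (k +_) (sum-blocks 1 b)

multinomial-0∷ : ∀ α → multinomial (0 ∷ α) ≡ multinomial α
multinomial-0∷ α = +-identityʳ (multinomial α)

multinomial-[n] : ∀ n → multinomial (n ∷ []) ≡ 1
multinomial-[n] n = cong (_* 1) (trans (cong (_C n) (+-identityʳ n)) (nCn≡1 n))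

firstBlockRemoval : ℕ → List Bool → ℕ
firstBlockRemoval k (true ∷ b) = multinomial (k ∷ blocks 1 b)
firstBlockRemoval k _          = 0

-- The multinomial recurrence (n choose α) = ∑ᵢ (n - 1 choose α - eᵢ), organised along the
-- bits of the descent set.
multinomial-recurrence : ∀ k b₀ b →
  ∑ (multinomial ∘ blocks (suc k)) (removeMaxBoundsAfterHead (b₀ ∷ b)) + firstBlockRemoval k (b₀ ∷ b)
    ≡ multinomial (blocks (suc k) (b₀ ∷ b))
multinomial-recurrence k false [] =
  trans (+-identityʳ _) (trans (+-identityʳ _) (trans (multinomial-[n] (suc k)) (sym (multinomial-[n] (suc (suc k))))))
multinomial-recurrence k true [] =
  trans (cong₂ _+_ (trans (+-identityʳ _) (multinomial-[n] (suc k))) (cong (_* 1) ([n+1]Cn≡1+n k)))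
        (sym (cong (_* 1) ([n+1]Cn≡1+n (suc k))))
multinomial-recurrence k false (b₁ ∷ b) = begin
  ∑ f (removeMaxBoundsAfterHead (false ∷ b₁ ∷ b)) + 0
    ≡⟨ +-identityʳ _ ⟩
  ∑ f ((if b₁ then (true ∷ b) ∷ [] else []) ++ map (false ∷_) (removeMaxBoundsAfterHead (b₁ ∷ b)))
    ≡⟨ ∑-++ f (if b₁ then (true ∷ b) ∷ [] else []) _ ⟩
  ∑ f (if b₁ then (true ∷ b) ∷ [] else []) + ∑ f (map (false ∷_) (removeMaxBoundsAfterHead (b₁ ∷ b)))
    ≡⟨ cong (∑ f (if b₁ then (true ∷ b) ∷ [] else []) +_) (∑-map f (false ∷_) (removeMaxBoundsAfterHead (b₁ ∷ b))) ⟩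
  ∑ f (if b₁ then (true ∷ b) ∷ [] else []) + ∑ (multinomial ∘ blocks (suc (suc k))) (removeMaxBoundsAfterHead (b₁ ∷ b))
    ≡⟨ shift b₁ ⟩
  multinomial (blocks (suc (suc k)) (b₁ ∷ b))
    ∎
  where
  open ≡-Reasoning
  f : List Bool → ℕ
  f = multinomial ∘ blocks (suc k)
  shift : ∀ b₁ → ∑ f (if b₁ then (true ∷ b) ∷ [] else [])
                   + ∑ (multinomial ∘ blocks (suc (suc k))) (removeMaxBoundsAfterHead (b₁ ∷ b))
               ≡ multinomial (blocks (suc (suc k)) (b₁ ∷ b))
  shift false = trans (sym (+-identityʳ _)) (multinomial-recurrence (suc k) false b)
  shift true  = trans (cong (_+ R) (+-identityʳ (multinomial (suc k ∷ blocks 1 b))))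
                      (trans (+-comm (multinomial (suc k ∷ blocks 1 b)) R) (multinomial-recurrence (suc k) true b))
    where
    R : ℕ
    R = ∑ (multinomial ∘ blocks (suc (suc k))) (removeMaxBoundsAfterHead (true ∷ b))
multinomial-recurrence k true (b₁ ∷ b) = begin
  ∑ f (removeMaxBoundsAfterHead (true ∷ b₁ ∷ b)) + multinomial (k ∷ β)
    ≡⟨ cong (_+ multinomial (k ∷ β)) (∑-++ f (if b₁ then (true ∷ b) ∷ [] else []) _) ⟩
  (∑ f (if b₁ then (true ∷ b) ∷ [] else []) + ∑ f (map (true ∷_) (removeMaxBoundsAfterHead (b₁ ∷ b)))) + multinomial (k ∷ β)
    ≡⟨ cong (λ z → (∑ f (if b₁ then (true ∷ b) ∷ [] else []) + z) + multinomial (k ∷ β)) tail-terms ⟩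
  (∑ f (if b₁ then (true ∷ b) ∷ [] else []) + κ * S) + multinomial (k ∷ β)
    ≡⟨ cong (λ z → (z + κ * S) + multinomial (k ∷ β)) (head-term b₁) ⟩
  (κ * firstBlockRemoval 0 (b₁ ∷ b) + κ * S) + multinomial (k ∷ β)
    ≡⟨ cong (_+ multinomial (k ∷ β)) (trans (sym (*-distribˡ-+ κ _ S))
         (cong (κ *_) (trans (+-comm _ S) (multinomial-recurrence 0 b₁ b)))) ⟩
  κ * Y + ((k + T) C k) * Y
    ≡⟨ sym (*-distribʳ-+ Y κ ((k + T) C k)) ⟩
  (κ + (k + T) C k) * Y
    ≡⟨ cong (_* Y) (trans (+-comm κ _) (trans (cong ((k + T) C k +_) κ≡) (sym (pascal (k + T) k)))) ⟩
  multinomial (suc k ∷ β)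
    ∎
  where
  open ≡-Reasoning
  f : List Bool → ℕ
  f = multinomial ∘ blocks (suc k)
  β : List ℕ
  β = blocks 1 (b₁ ∷ b)
  κ : ℕ
  κ = (suc k + suc (length b)) C suc k
  S : ℕ
  S = ∑ (multinomial ∘ blocks 1) (removeMaxBoundsAfterHead (b₁ ∷ b))
  Y : ℕ
  Y = multinomial β
  T : ℕ
  T = sum β
  κ≡ : κ ≡ (k + T) C suc k
  κ≡ = cong (_C suc k) (trans (sym (+-suc k (suc (length b)))) (cong (k +_) (sym (sum-blocks 1 (b₁ ∷ b)))))
  tail-terms : ∑ f (map (true ∷_) (removeMaxBoundsAfterHead (b₁ ∷ b))) ≡ κ * S
  tail-terms = trans (∑-map f (true ∷_) (removeMaxBoundsAfterHead (b₁ ∷ b)))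
    (trans (∑-cong-All (All.map (λ {q} lq → cong (λ z → ((suc k + z) C suc k) * multinomial (blocks 1 q))
                                                   (trans (sum-blocks 1 q) (cong suc lq)))
                                (removeMaxBoundsAfterHead-length (length b) (b₁ ∷ b) refl)))
           (∑-*ˡ κ (multinomial ∘ blocks 1) (removeMaxBoundsAfterHead (b₁ ∷ b))))
  head-term : ∀ b₁ → ∑ f (if b₁ then (true ∷ b) ∷ [] else []) ≡ κ * firstBlockRemoval 0 (b₁ ∷ b)
  head-term false = sym (*-zeroʳ κ)
  head-term true  = trans (+-identityʳ _)
    (trans (cong (λ z → ((suc k + z) C suc k) * multinomial (blocks 1 b)) (sum-blocks 1 b))
           (cong (κ *_) (sym (multinomial-0∷ (blocks 1 b)))))

∑-blockMultinomial-removeMaxBounds : ∀ b₀ b → ∑ blockMultinomial (removeMaxBounds (b₀ ∷ b)) ≡ blockMultinomial (b₀ ∷ b)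
∑-blockMultinomial-removeMaxBounds b₀ b =
  trans (∑-++ blockMultinomial (if b₀ then b ∷ [] else []) (removeMaxBoundsAfterHead (b₀ ∷ b)))
  (trans (+-comm (∑ blockMultinomial (if b₀ then b ∷ [] else [])) R)
  (trans (cong (R +_) (head-term b₀)) (multinomial-recurrence 0 b₀ b)))
  where
  R : ℕ
  R = ∑ blockMultinomial (removeMaxBoundsAfterHead (b₀ ∷ b))
  head-term : ∀ b₀ → ∑ blockMultinomial (if b₀ then b ∷ [] else []) ≡ firstBlockRemoval 0 (b₀ ∷ b)
  head-term false = refl
  head-term true  = trans (+-identityʳ _) (sym (multinomial-0∷ (blocks 1 b)))

countWithin≡blockMultinomial : ∀ L b → length b ≡ L → countWithin L b ≡ blockMultinomial b
countWithin≡blockMultinomial zero    []       _ = refl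
countWithin≡blockMultinomial (suc L) (b₀ ∷ b) e =
  trans (countWithin-suc L (b₀ ∷ b) e)
  (trans (∑-cong-All (All.map (λ {q} → countWithin≡blockMultinomial L q) (removeMaxBounds-length L (b₀ ∷ b) e)))
         (∑-blockMultinomial-removeMaxBounds b₀ b))

∑⊆ : (List Bool → ℕ) → List Bool → ℕ
∑⊆ f []          = f []
∑⊆ f (false ∷ b) = ∑⊆ (f ∘ (false ∷_)) b
∑⊆ f (true ∷ b)  = ∑⊆ (f ∘ (false ∷_)) b + ∑⊆ (f ∘ (true ∷_)) b

∑⊆-0 : ∀ b → ∑⊆ (λ _ → 0) b ≡ 0
∑⊆-0 []          = refl
∑⊆-0 (false ∷ b) = ∑⊆-0 b
∑⊆-0 (true ∷ b)  = cong₂ _+_ (∑⊆-0 b) (∑⊆-0 b)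

∑⊆-*ˡ : ∀ c f b → ∑⊆ (λ x → c * f x) b ≡ c * ∑⊆ f b
∑⊆-*ˡ c f []          = refl
∑⊆-*ˡ c f (false ∷ b) = ∑⊆-*ˡ c (f ∘ (false ∷_)) b
∑⊆-*ˡ c f (true ∷ b)  = trans (cong₂ _+_ (∑⊆-*ˡ c (f ∘ (false ∷_)) b) (∑⊆-*ˡ c (f ∘ (true ∷_)) b))
                               (sym (*-distribˡ-+ c _ _))

∑⊆-∑ : ∀ (h : A → List Bool → ℕ) xs b → ∑⊆ (λ x → ∑ (λ w → h w x) xs) b ≡ ∑ (λ w → ∑⊆ (h w) b) xs
∑⊆-∑ h xs []          = refl
∑⊆-∑ h xs (false ∷ b) = ∑⊆-∑ (λ w → h w ∘ (false ∷_)) xs b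
∑⊆-∑ h xs (true ∷ b)  = trans (cong₂ _+_ (∑⊆-∑ (λ w → h w ∘ (false ∷_)) xs b) (∑⊆-∑ (λ w → h w ∘ (true ∷_)) xs b))
                              (sym (∑-+ (λ w → ∑⊆ (h w ∘ (false ∷_)) b) (λ w → ∑⊆ (h w ∘ (true ∷_)) b) xs))

∑⊆-== : ∀ u b → length u ≡ length b → ∑⊆ (λ x → 𝟙 (u == x)) b ≡ 𝟙 (u ⊆ᵇ b)
∑⊆-== []          []          _ = refl
∑⊆-== (false ∷ u) (false ∷ b) e = ∑⊆-== u b (suc-injective e)
∑⊆-== (true ∷ u)  (false ∷ b) _ = ∑⊆-0 b
∑⊆-== (false ∷ u) (true ∷ b)  e =
  trans (cong₂ _+_ (∑⊆-== u b (suc-injective e)) (∑⊆-0 b)) (+-identityʳ (𝟙 (u ⊆ᵇ b)))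
∑⊆-== (true ∷ u)  (true ∷ b)  e = cong₂ _+_ (∑⊆-0 b) (∑⊆-== u b (suc-injective e))

countWithin≡∑⊆countExactly : ∀ L b → length b ≡ L → countWithin L b ≡ ∑⊆ (countExactly L) b
countWithin≡∑⊆countExactly L b e = sym (trans
  (∑⊆-∑ (λ w x → 𝟙 (descentBits w == x)) (perms (suc L)) b)
  (∑-cong-All (All.map (λ {w} (l , _) → ∑⊆-== (descentBits w) b (trans (length-descentBits L w l) (sym e)))
                       (perms-Word (suc L)))))

allBits : ℕ → List (List Bool)
allBits zero    = [] ∷ []
allBits (suc n) = map (true ∷_) (allBits n) ++ map (false ∷_) (allBits n)

allBits-length : ∀ n → All (λ b → length b ≡ n) (allBits n)
allBits-length zero    = refl ∷ []
allBits-length (suc n) = ++⁺ (map⁺ (All.map (cong suc) (allBits-length n))) (map⁺ (All.map (cong suc) (allBits-length n)))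

∑-allBits-suc : ∀ (h : List Bool → ℕ) n →
  ∑ h (allBits (suc n)) ≡ ∑ (h ∘ (true ∷_)) (allBits n) + ∑ (h ∘ (false ∷_)) (allBits n)
∑-allBits-suc h n = trans (∑-++ h (map (true ∷_) (allBits n)) (map (false ∷_) (allBits n)))
                          (cong₂ _+_ (∑-map h (true ∷_) (allBits n)) (∑-map h (false ∷_) (allBits n)))

partBits : ℕ → List ℕ → List Bool
partBits zero          α       = []
partBits (suc zero)    []      = []
partBits (suc zero)    (b ∷ α) = true ∷ partBits b α
partBits (suc (suc a)) α       = false ∷ partBits (suc a) α

compositionBits : List ℕ → List Bool
compositionBits []      = []
compositionBits (a ∷ α) = partBits a α

truePositions : ℕ → List Bool → List ℕ
truePositions k []          = []
truePositions k (true ∷ u)  = k ∷ truePositions (suc k) u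
truePositions k (false ∷ u) = truePositions (suc k) u

descentsFrom≡truePositions : ∀ k w → descentsFrom k w ≡ truePositions k (descentBits w)
descentsFrom≡truePositions k []          = refl
descentsFrom≡truePositions k (a ∷ [])    = refl
descentsFrom≡truePositions k (a ∷ b ∷ w) = by-bit (b <ᵇ a) (descentsFrom≡truePositions (suc k) (b ∷ w))
  where
  by-bit : ∀ x → descentsFrom (suc k) (b ∷ w) ≡ truePositions (suc k) (descentBits (b ∷ w)) →
    (if x then k ∷ descentsFrom (suc k) (b ∷ w) else descentsFrom (suc k) (b ∷ w)) ≡ truePositions k (x ∷ descentBits (b ∷ w))
  by-bit true  IH = cong (k ∷_) IH
  by-bit false IH = IH

partialSums≡truePositions : ∀ a α s → All (0 <_) α →
  partialSums s (suc a ∷ α) ≡ truePositions (suc s) (partBits (suc a) α)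
partialSums≡truePositions zero    []          s _            = refl
partialSums≡truePositions zero    (suc b ∷ α) s (_ ∷ 0<α) =
  trans (cong (λ z → z ∷ partialSums z (suc b ∷ α)) (+-comm s 1))
        (cong (suc s ∷_) (partialSums≡truePositions b α (suc s) 0<α))
partialSums≡truePositions (suc a) α           s 0<α =
  trans (shift α) (partialSums≡truePositions a α (suc s) 0<α)
  where
  shift : ∀ α → partialSums s (suc (suc a) ∷ α) ≡ partialSums (suc s) (suc a ∷ α)
  shift []      = refl
  shift (b ∷ α) = cong (λ z → z ∷ partialSums z (b ∷ α)) (+-suc s (suc a))

truePositions-≥ : ∀ k u → All (k ≤_) (truePositions k u)
truePositions-≥ k []          = []
truePositions-≥ k (true ∷ u)  = ≤-refl ∷ All.map (≤-trans (n≤1+n k)) (truePositions-≥ (suc k) u)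
truePositions-≥ k (false ∷ u) = All.map (≤-trans (n≤1+n k)) (truePositions-≥ (suc k) u)

k∷xs≢All>k : ∀ {k xs ys} → All (k <_) ys → k ∷ xs ≢ ys
k∷xs≢All>k (k<y ∷ _) refl = <-irrefl refl k<y

truePositions-injective : ∀ k u v → length u ≡ length v → truePositions k u ≡ truePositions k v → u ≡ v
truePositions-injective k []          []          _ _ = refl
truePositions-injective k (true ∷ u)  (true ∷ v)  l e =
  cong (true ∷_) (truePositions-injective (suc k) u v (suc-injective l) (∷-injectiveʳ e))
truePositions-injective k (false ∷ u) (false ∷ v) l e =
  cong (false ∷_) (truePositions-injective (suc k) u v (suc-injective l) e)
truePositions-injective k (true ∷ u)  (false ∷ v) _ e = ⊥-elim (k∷xs≢All>k (truePositions-≥ (suc k) v) e)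
truePositions-injective k (false ∷ u) (true ∷ v)  _ e = ⊥-elim (k∷xs≢All>k (truePositions-≥ (suc k) u) (sym e))

==⇒≡ : ∀ u v → (u == v) ≡ true → u ≡ v
==⇒≡ []          []          _  = refl
==⇒≡ (false ∷ u) (false ∷ v) e  = cong (false ∷_) (==⇒≡ u v e)
==⇒≡ (true ∷ u)  (true ∷ v)  e  = cong (true ∷_) (==⇒≡ u v e)
==⇒≡ []          (_ ∷ _)     ()
==⇒≡ (_ ∷ _)     []          ()
==⇒≡ (false ∷ u) (true ∷ v)  ()
==⇒≡ (true ∷ u)  (false ∷ v) ()

==-refl : ∀ u → (u == u) ≡ true
==-refl []          = refl
==-refl (false ∷ u) = ==-refl u
==-refl (true ∷ u)  = ==-refl u

does-truePositions-≟ : ∀ u v → length u ≡ length v →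
  does (≡-dec _≟_ (truePositions 1 u) (truePositions 1 v)) ≡ (u == v)
does-truePositions-≟ u v l with u == v in eq
... | true  = dec-true (≡-dec _≟_ _ _) (cong (truePositions 1) (==⇒≡ u v eq))
... | false = dec-false (≡-dec _≟_ _ _) (λ e → u≢v (truePositions-injective 1 u v l e))
  where
  u≢v : u ≢ v
  u≢v refl with trans (sym eq) (==-refl u)
  ... | ()

IsComposition : ℕ → List ℕ → Set
IsComposition m α = sum α ≡ m × All (0 <_) α × suc (length (compositionBits α)) ≡ m

compositions-IsComposition : ∀ n → All (IsComposition (suc n)) (compositions (suc n))
compositions-IsComposition zero    = (refl , z<s ∷ [] , refl) ∷ []
compositions-IsComposition (suc n) =
  ++⁺ (map⁺ (All.map prepend-1 (compositions-IsComposition n)))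
      (map⁺ (All.map increment-first (compositions-IsComposition n)))
  where
  prepend-1 : ∀ {α} → IsComposition (suc n) α → IsComposition (suc (suc n)) (1 ∷ α)
  prepend-1 {suc _ ∷ _} (s , 0<α , l) = cong suc s , z<s ∷ 0<α , cong suc l
  prepend-1 {zero ∷ _}  (_ , () ∷ _ , _)
  increment-first : ∀ {α} → IsComposition (suc n) α → IsComposition (suc (suc n)) (incrFirst α)
  increment-first {suc _ ∷ _} (s , _ ∷ 0<α , l) = cong suc s , z<s ∷ 0<α , cong suc l

compositionBits-compositions : ∀ n → map compositionBits (compositions (suc n)) ≡ allBits n
compositionBits-compositions zero    = refl
compositionBits-compositions (suc n) = begin
  map compositionBits (map (1 ∷_) αs ++ map incrFirst αs)
    ≡⟨ map-++ compositionBits (map (1 ∷_) αs) (map incrFirst αs) ⟩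
  map compositionBits (map (1 ∷_) αs) ++ map compositionBits (map incrFirst αs)
    ≡⟨ cong₂ _++_ (by-first-part prepend-1) (by-first-part increment-first) ⟩
  map (true ∷_) (allBits n) ++ map (false ∷_) (allBits n)
    ∎
  where
  open ≡-Reasoning
  αs : List (List ℕ)
  αs = compositions (suc n)
  by-first-part : ∀ {f : List ℕ → List ℕ} {x} →
    (∀ {α} → IsComposition (suc n) α → compositionBits (f α) ≡ x ∷ compositionBits α) →
    map compositionBits (map f αs) ≡ map (x ∷_) (allBits n)
  by-first-part {f} {x} bits-f = begin
    map compositionBits (map f αs)        ≡⟨ map-∘ αs ⟨
    map (compositionBits ∘ f) αs          ≡⟨ map-cong-local (All.map bits-f (compositions-IsComposition n)) ⟩
    map ((x ∷_) ∘ compositionBits) αs     ≡⟨ map-∘ αs ⟩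
    map (x ∷_) (map compositionBits αs)   ≡⟨ cong (map (x ∷_)) (compositionBits-compositions n) ⟩
    map (x ∷_) (allBits n)                ∎
  prepend-1 : ∀ {α} → IsComposition (suc n) α → compositionBits (1 ∷ α) ≡ true ∷ compositionBits α
  prepend-1 {suc _ ∷ _} _                = refl
  prepend-1 {zero ∷ _}  (_ , () ∷ _ , _)
  increment-first : ∀ {α} → IsComposition (suc n) α → compositionBits (incrFirst α) ≡ false ∷ compositionBits α
  increment-first {suc _ ∷ _} _                = refl
  increment-first {zero ∷ _}  (_ , () ∷ _ , _)

ribbon≡countExactly : ∀ n α → IsComposition (suc n) α → ribbon α ≡ countExactly n (compositionBits α)
ribbon≡countExactly n (suc a ∷ α) (s , _ ∷ 0<α , l) = begin
  length (filter (λ w → ≡-dec _≟_ (descents w) (descentSetOfComp (suc a ∷ α))) (perms (sum (suc a ∷ α))))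
    ≡⟨ cong (λ m → length (filter (λ w → ≡-dec _≟_ (descents w) (descentSetOfComp (suc a ∷ α))) (perms m))) s ⟩
  length (filter (λ w → ≡-dec _≟_ (descents w) (descentSetOfComp (suc a ∷ α))) (perms (suc n)))
    ≡⟨ length-filter≡∑𝟙 _ (perms (suc n)) ⟩
  ∑ (λ w → 𝟙 (does (≡-dec _≟_ (descents w) (descentSetOfComp (suc a ∷ α))))) (perms (suc n))
    ≡⟨ ∑-cong-All (All.map same-descents (perms-Word (suc n))) ⟩
  countExactly n (partBits (suc a) α)
    ∎
  where
  open ≡-Reasoning
  same-descents : ∀ {w} → Word (suc n) w →
    𝟙 (does (≡-dec _≟_ (descents w) (descentSetOfComp (suc a ∷ α)))) ≡ 𝟙 (descentBits w == partBits (suc a) α)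
  same-descents {w} (lw , _) rewrite descentsFrom≡truePositions 1 w | partialSums≡truePositions a α 0 0<α =
    cong 𝟙 (does-truePositions-≟ (descentBits w) (partBits (suc a) α)
                                  (trans (length-descentBits n w lw) (suc-injective (sym l))))

#ribbons : {P : ℕ → Set} → ((x : ℕ) → Dec (P x)) → ℕ → ℕ
#ribbons P? m = length (filter (λ γ → P? (ribbon γ)) (compositions m))

#ribbons≡∑-allBits : ∀ {P : ℕ → Set} (P? : (x : ℕ) → Dec (P x)) n →
  #ribbons P? (suc n) ≡ ∑ (λ b → 𝟙 (does (P? (countExactly n b)))) (allBits n)
#ribbons≡∑-allBits P? n = begin
  length (filter (λ γ → P? (ribbon γ)) (compositions (suc n)))
    ≡⟨ length-filter≡∑𝟙 (λ γ → P? (ribbon γ)) (compositions (suc n)) ⟩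
  ∑ (λ γ → 𝟙 (does (P? (ribbon γ)))) (compositions (suc n))
    ≡⟨ ∑-cong-All (All.map (λ {γ} γ-comp → cong (𝟙 ∘ does ∘ P?) (ribbon≡countExactly n γ γ-comp))
                           (compositions-IsComposition n)) ⟩
  ∑ (λ γ → 𝟙 (does (P? (countExactly n (compositionBits γ))))) (compositions (suc n))
    ≡⟨ ∑-map (λ b → 𝟙 (does (P? (countExactly n b)))) compositionBits (compositions (suc n)) ⟨
  ∑ (λ b → 𝟙 (does (P? (countExactly n b)))) (map compositionBits (compositions (suc n)))
    ≡⟨ cong (∑ (λ b → 𝟙 (does (P? (countExactly n b))))) (compositionBits-compositions n) ⟩
  ∑ (λ b → 𝟙 (does (P? (countExactly n b)))) (allBits n)
    ∎
  where open ≡-Reasoning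

-- Bits are indexed from 0, and with q = q-1 + 1 the grid positions of a bit list are
-- t, t + q, t + 2q, … when t off-grid positions precede the first grid position.
module Grid (q-1 : ℕ) where

  q : ℕ
  q = suc q-1

  gridBits : ℕ → List Bool → List Bool
  gridBits t       []      = []
  gridBits zero    (x ∷ b) = x ∷ gridBits q-1 b
  gridBits (suc t) (x ∷ b) = gridBits t b

  offGridClear : ℕ → List Bool → Bool
  offGridClear t       []      = true
  offGridClear zero    (x ∷ b) = offGridClear q-1 b
  offGridClear (suc t) (x ∷ b) = not x ∧ offGridClear t b

  offGridParity : ℕ → List Bool → Bool
  offGridParity t       []      = false
  offGridParity zero    (x ∷ b) = offGridParity q-1 b
  offGridParity (suc t) (x ∷ b) = x xor offGridParity t b

  length-gridBits : ∀ b t r → length b ≡ t + r * q → length (gridBits t b) ≡ r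
  length-gridBits []      zero    zero    _ = refl
  length-gridBits (x ∷ b) zero    (suc r) e = cong suc (length-gridBits b q-1 r (suc-injective e))
  length-gridBits (x ∷ b) (suc t) r       e = length-gridBits b t r (suc-injective e)

  gridSum : (List Bool → Bool → ℕ) → ℕ → ℕ → ℕ
  gridSum F t L = ∑ (λ b → F (gridBits t b) (offGridParity t b)) (allBits L)

  flipParity : (List Bool → Bool → ℕ) → List Bool → Bool → ℕ
  flipParity F c π = F c (not π)

  -- Each c of length r is the grid part of 2 ^ (t + r * q-1) bit lists of length t + r * q.
  gridSum+gridSum-flipParity : ∀ F t r →
    gridSum F t (t + r * q) + gridSum (flipParity F) t (t + r * q) ≡ 2 ^ (t + r * q-1) * ∑ (λ c → F c false + F c true) (allBits r)
  gridSum+gridSum-flipParity F zero zero = double-base (F [] false) (F [] true)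
    where
    double-base : ∀ a b → (a + 0) + (b + 0) ≡ 1 * ((a + b) + 0)
    double-base = solve-∀
  gridSum+gridSum-flipParity F (suc t) r = begin
    gridSum F (suc t) (suc L) + gridSum (flipParity F) (suc t) (suc L)
      ≡⟨ cong₂ _+_ (∑-allBits-suc _ L) (∑-allBits-suc _ L) ⟩
    (gridSum (flipParity F) t L + gridSum F t L) + (gridSum (flipParity (flipParity F)) t L + gridSum (flipParity F) t L)
      ≡⟨ cong (λ z → (gridSum (flipParity F) t L + gridSum F t L) + (z + gridSum (flipParity F) t L))
              (∑-cong (allBits L) (λ b → cong (F (gridBits t b)) (not-involutive (offGridParity t b)))) ⟩
    (gridSum (flipParity F) t L + gridSum F t L) + (gridSum F t L + gridSum (flipParity F) t L)
      ≡⟨ cong₂ _+_ (trans (+-comm (gridSum (flipParity F) t L) _) IH) IH ⟩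
    2 ^ (t + r * q-1) * S + 2 ^ (t + r * q-1) * S
      ≡⟨ cong (2 ^ (t + r * q-1) * S +_) (+-identityʳ (2 ^ (t + r * q-1) * S)) ⟨
    2 * (2 ^ (t + r * q-1) * S)
      ≡⟨ *-assoc 2 (2 ^ (t + r * q-1)) S ⟨
    2 ^ (suc t + r * q-1) * S
      ∎
    where
    open ≡-Reasoning
    L : ℕ
    L = t + r * q
    S : ℕ
    S = ∑ (λ c → F c false + F c true) (allBits r)
    IH : gridSum F t L + gridSum (flipParity F) t L ≡ 2 ^ (t + r * q-1) * S
    IH = gridSum+gridSum-flipParity F t r
  gridSum+gridSum-flipParity F zero (suc r) = begin
    gridSum F 0 (suc L) + gridSum (flipParity F) 0 (suc L)
      ≡⟨ cong₂ _+_ (∑-allBits-suc _ L) (∑-allBits-suc _ L) ⟩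
    (gridSum F₁ q-1 L + gridSum F₀ q-1 L) + (gridSum (flipParity F₁) q-1 L + gridSum (flipParity F₀) q-1 L)
      ≡⟨ interchange (gridSum F₁ q-1 L) (gridSum F₀ q-1 L) (gridSum (flipParity F₁) q-1 L) (gridSum (flipParity F₀) q-1 L) ⟩
    (gridSum F₁ q-1 L + gridSum (flipParity F₁) q-1 L) + (gridSum F₀ q-1 L + gridSum (flipParity F₀) q-1 L)
      ≡⟨ cong₂ _+_ (gridSum+gridSum-flipParity F₁ q-1 r) (gridSum+gridSum-flipParity F₀ q-1 r) ⟩
    2 ^ (q-1 + r * q-1) * S F₁ + 2 ^ (q-1 + r * q-1) * S F₀
      ≡⟨ *-distribˡ-+ (2 ^ (q-1 + r * q-1)) (S F₁) (S F₀) ⟨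
    2 ^ (q-1 + r * q-1) * (S F₁ + S F₀)
      ≡⟨ cong (2 ^ (q-1 + r * q-1) *_) (∑-allBits-suc (λ c → F c false + F c true) r) ⟨
    2 ^ (q-1 + r * q-1) * ∑ (λ c → F c false + F c true) (allBits (suc r))
      ∎
    where
    open ≡-Reasoning
    L : ℕ
    L = q-1 + r * q
    F₀ F₁ : List Bool → Bool → ℕ
    F₀ c π = F (false ∷ c) π
    F₁ c π = F (true ∷ c) π
    S : (List Bool → Bool → ℕ) → ℕ
    S G = ∑ (λ c → G c false + G c true) (allBits r)
    interchange : ∀ a b c d → (a + b) + (c + d) ≡ (a + c) + (b + d)
    interchange = solve-∀

  -- Toggling the first off-grid bit flips the parity and fixes the grid part.
  gridSum≡gridSum-flipParity : 1 ≤ q-1 → ∀ F t r → 1 ≤ t + r * q → gridSum F t (t + r * q) ≡ gridSum (flipParity F) t (t + r * q)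
  gridSum≡gridSum-flipParity 1≤q-1 F (suc t) r _ = begin
    gridSum F (suc t) (suc L)
      ≡⟨ ∑-allBits-suc _ L ⟩
    gridSum (flipParity F) t L + gridSum F t L
      ≡⟨ +-comm (gridSum (flipParity F) t L) _ ⟩
    gridSum F t L + gridSum (flipParity F) t L
      ≡⟨ cong (_+ gridSum (flipParity F) t L)
              (∑-cong (allBits L) (λ b → cong (F (gridBits t b)) (sym (not-involutive (offGridParity t b))))) ⟩
    gridSum (flipParity (flipParity F)) t L + gridSum (flipParity F) t L
      ≡⟨ ∑-allBits-suc _ L ⟨
    gridSum (flipParity F) (suc t) (suc L)
      ∎
    where
    open ≡-Reasoning
    L : ℕ
    L = t + r * q
  gridSum≡gridSum-flipParity 1≤q-1 F zero (suc r) _ = begin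
    gridSum F 0 (suc L)
      ≡⟨ ∑-allBits-suc _ L ⟩
    gridSum (λ c → F (true ∷ c)) q-1 L + gridSum (λ c → F (false ∷ c)) q-1 L
      ≡⟨ cong₂ _+_ (gridSum≡gridSum-flipParity 1≤q-1 (λ c → F (true ∷ c)) q-1 r 1≤L)
                   (gridSum≡gridSum-flipParity 1≤q-1 (λ c → F (false ∷ c)) q-1 r 1≤L) ⟩
    gridSum (flipParity (λ c → F (true ∷ c))) q-1 L + gridSum (flipParity (λ c → F (false ∷ c))) q-1 L
      ≡⟨ ∑-allBits-suc _ L ⟨
    gridSum (flipParity F) 0 (suc L)
      ∎
    where
    open ≡-Reasoning
    L : ℕ
    L = q-1 + r * q
    1≤L : 1 ≤ L
    1≤L = ≤-trans 1≤q-1 (m≤m+n q-1 (r * q))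

  2*gridSum : 1 ≤ q-1 → ∀ F r →
    2 * gridSum F q-1 (q-1 + r * q) ≡ 2 ^ (q-1 + r * q-1) * ∑ (λ c → F c false + F c true) (allBits r)
  2*gridSum 1≤q-1 F r = begin
    2 * gridSum F q-1 L
      ≡⟨ cong (gridSum F q-1 L +_) (+-identityʳ _) ⟩
    gridSum F q-1 L + gridSum F q-1 L
      ≡⟨ cong (gridSum F q-1 L +_) (gridSum≡gridSum-flipParity 1≤q-1 F q-1 r (≤-trans 1≤q-1 (m≤m+n q-1 (r * q)))) ⟩
    gridSum F q-1 L + gridSum (flipParity F) q-1 L
      ≡⟨ gridSum+gridSum-flipParity F q-1 r ⟩
    2 ^ (q-1 + r * q-1) * ∑ (λ c → F c false + F c true) (allBits r)
      ∎
    where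
    open ≡-Reasoning
    L : ℕ
    L = q-1 + r * q

module Modulo (p-1 : ℕ) where

  p : ℕ
  p = suc p-1

  infix 4 _≋_
  record _≋_ (a b : ℕ) : Set where
    constructor mk≋
    field ≋⇒%≡ : a % p ≡ b % p
  open _≋_ public

  ≋-isEquivalence : IsEquivalence _≋_
  ≋-isEquivalence = record
    { refl  = mk≋ refl
    ; sym   = λ (mk≋ e) → mk≋ (sym e)
    ; trans = λ (mk≋ e) (mk≋ f) → mk≋ (trans e f)
    }

  ≋-setoid : Setoid _ _
  ≋-setoid = record { isEquivalence = ≋-isEquivalence }

  module ≋-Reasoning = Relation.Binary.Reasoning.Setoid ≋-setoid

  open IsEquivalence ≋-isEquivalence public
    using () renaming (refl to ≋-refl; sym to ≋-sym; trans to ≋-trans; reflexive to ≡⇒≋)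

  +-cong-≋ : ∀ {a b c d} → a ≋ b → c ≋ d → a + c ≋ b + d
  +-cong-≋ {a} {b} {c} {d} (mk≋ e) (mk≋ f) = mk≋ (begin
    (a + c) % p           ≡⟨ %-distribˡ-+ a c p ⟩
    (a % p + c % p) % p   ≡⟨ cong₂ (λ x y → (x + y) % p) e f ⟩
    (b % p + d % p) % p   ≡⟨ %-distribˡ-+ b d p ⟨
    (b + d) % p           ∎)
    where open ≡-Reasoning

  *-cong-≋ : ∀ {a b c d} → a ≋ b → c ≋ d → a * c ≋ b * d
  *-cong-≋ {a} {b} {c} {d} (mk≋ e) (mk≋ f) = mk≋ (begin
    (a * c) % p               ≡⟨ %-distribˡ-* a c p ⟩
    (a % p * (c % p)) % p     ≡⟨ cong₂ (λ x y → (x * y) % p) e f ⟩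
    (b % p * (d % p)) % p     ≡⟨ %-distribˡ-* b d p ⟨
    (b * d) % p               ∎)
    where open ≡-Reasoning

  m*p≋0 : ∀ m → m * p ≋ 0
  m*p≋0 m = mk≋ (m*n%n≡0 m p)

  m+n*p≋m : ∀ m n → m + n * p ≋ m
  m+n*p≋m m n = mk≋ ([m+kn]%n≡m%n m n p)

  p≋0 : p ≋ 0
  p≋0 = ≋-trans (≡⇒≋ (sym (*-identityˡ p))) (m*p≋0 1)

  -- Adding a * (p - 1) to both sides turns the summand a into a multiple of p.
  +-cancelˡ-≋ : ∀ {a b m n} → a ≋ b → a + m ≋ b + n → m ≋ n
  +-cancelˡ-≋ {a} {b} {m} {n} a≋b a+m≋b+n = begin
    m                     ≈⟨ m+n*p≋m m a ⟨
    m + a * p             ≡⟨ spread m a p-1 ⟩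
    (a + m) + a * p-1     ≈⟨ +-cong-≋ a+m≋b+n (*-cong-≋ a≋b (≋-refl {p-1})) ⟩
    (b + n) + b * p-1     ≡⟨ spread n b p-1 ⟨
    n + b * p             ≈⟨ m+n*p≋m n b ⟩
    n                     ∎
    where
    open ≋-Reasoning
    spread : ∀ x a c → x + a * suc c ≡ (a + x) + a * c
    spread = solve-∀

  p-1*p-1≋1 : p-1 * p-1 ≋ 1
  p-1*p-1≋1 = +-cancelˡ-≋ (≋-refl {p-1}) (begin
    p-1 + p-1 * p-1   ≡⟨ *-suc p-1 p-1 ⟨
    p-1 * p           ≈⟨ m*p≋0 p-1 ⟩
    0                 ≈⟨ p≋0 ⟨
    p                 ≡⟨ +-comm 1 p-1 ⟩
    p-1 + 1           ∎)
    where open ≋-Reasoning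

  module _ (p-prime : Prime p) where

    pC[1+k]≋0 : ∀ {k} → suc k < p → p C suc k ≋ 0
    pC[1+k]≋0 {k} 1+k<p
      with euclidsLemma (p C suc k) (suc k) p-prime
             (divides (p-1 C k) (trans ([1+n]C[1+k]*[1+k]≡[1+n]*nCk p-1 k) (*-comm p (p-1 C k))))
    ... | inj₁ p∣pC[1+k] = mk≋ (n∣m⇒m%n≡0 _ p p∣pC[1+k])
    ... | inj₂ p∣1+k     = ⊥-elim (<⇒≱ 1+k<p (∣⇒≤ p∣1+k))

    [p+n]Ck≋nCk : ∀ n {k} → k < p → (p + n) C k ≋ n C k
    [p+n]Ck≋nCk zero    {zero}  _   = ≋-refl
    [p+n]Ck≋nCk zero    {suc k} k<p = subst (λ x → x C suc k ≋ 0) (sym (+-identityʳ p)) (pC[1+k]≋0 k<p)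
    [p+n]Ck≋nCk (suc n) {zero}  _   = ≋-refl
    [p+n]Ck≋nCk (suc n) {suc k} k<p = begin
      (p + suc n) C suc k             ≡⟨ cong (_C suc k) (+-suc p n) ⟩
      suc (p + n) C suc k             ≡⟨ pascal (p + n) k ⟩
      (p + n) C k + (p + n) C suc k   ≈⟨ +-cong-≋ ([p+n]Ck≋nCk n (<-trans (n<1+n k) k<p)) ([p+n]Ck≋nCk n k<p) ⟩
      n C k + n C suc k               ≡⟨ pascal n k ⟨
      suc n C suc k                   ∎
      where open ≋-Reasoning

    -- The coefficient form of (1 + x) ^ (p + n) ≡ (1 + x ^ p) (1 + x) ^ n.
    [p+n]C[p+k]≋nC[p+k]+nCk : ∀ n k → (p + n) C (p + k) ≋ n C (p + k) + n C k
    [p+n]C[p+k]≋nC[p+k]+nCk zero zero = ≡⇒≋ (nCn≡1 (p + 0))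
    [p+n]C[p+k]≋nC[p+k]+nCk zero (suc k) = ≡⇒≋ (k>n⇒nCk≡0 (+-monoʳ-< p {0} {suc k} z<s))
    [p+n]C[p+k]≋nC[p+k]+nCk (suc n) k = begin
      (p + suc n) C (p + k)                          ≡⟨ cong (_C (p + k)) (+-suc p n) ⟩
      suc (p + n) C suc (p-1 + k)                    ≡⟨ pascal (p + n) (p-1 + k) ⟩
      (p + n) C (p-1 + k) + (p + n) C (p + k)        ≈⟨ +-cong-≋ (below k) ([p+n]C[p+k]≋nC[p+k]+nCk n k) ⟩
      below-rhs k + (n C (p + k) + n C k)            ≈⟨ regroup k ⟩
      (n C (p-1 + k) + n C (p + k)) + suc n C k      ≡⟨ cong (_+ suc n C k) (pascal n (p-1 + k)) ⟨
      suc n C (p + k) + suc n C k                    ∎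
      where
      open ≋-Reasoning
      below-rhs : ℕ → ℕ
      below-rhs zero    = n C (p-1 + 0)
      below-rhs (suc k) = n C (p + k) + n C k
      below : ∀ k → (p + n) C (p-1 + k) ≋ below-rhs k
      below zero    = [p+n]Ck≋nCk n (s≤s (≤-reflexive (+-identityʳ p-1)))
      below (suc k) = subst (λ x → (p + n) C x ≋ below-rhs (suc k)) (sym (+-suc p-1 k))
                        ([p+n]C[p+k]≋nC[p+k]+nCk n k)
      regroup : ∀ k → below-rhs k + (n C (p + k) + n C k) ≋ (n C (p-1 + k) + n C (p + k)) + suc n C k
      regroup zero    = ≡⇒≋ (sym (+-assoc (n C (p-1 + 0)) (n C (p + 0)) 1))
      regroup (suc k) = begin
        (n C (p + k) + n C k) + (n C (p + suc k) + n C suc k)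
          ≡⟨ swap (n C (p + k)) (n C k) (n C (p + suc k)) (n C suc k) ⟩
        (n C (p + k) + n C (p + suc k)) + (n C k + n C suc k)
          ≡⟨ cong₂ (λ x y → (n C x + n C (p + suc k)) + y) (+-suc p-1 k) (pascal n k) ⟨
        (n C (p-1 + suc k) + n C (p + suc k)) + suc n C suc k
          ∎
        where
        swap : ∀ a b c d → (a + b) + (c + d) ≡ (a + c) + (b + d)
        swap = solve-∀

    [a*p]C[j*p]≋aCj : ∀ a j → (a * p) C (j * p) ≋ a C j
    [a*p]C[j*p]≋aCj zero    zero    = ≋-refl
    [a*p]C[j*p]≋aCj zero    (suc j) = ≋-refl
    [a*p]C[j*p]≋aCj (suc a) zero    = ≋-refl
    [a*p]C[j*p]≋aCj (suc a) (suc j) = begin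
      (p + a * p) C (p + j * p)                ≈⟨ [p+n]C[p+k]≋nC[p+k]+nCk (a * p) (j * p) ⟩
      (a * p) C (suc j * p) + (a * p) C (j * p) ≈⟨ +-cong-≋ ([a*p]C[j*p]≋aCj a (suc j)) ([a*p]C[j*p]≋aCj a j) ⟩
      a C suc j + a C j                        ≡⟨ +-comm (a C suc j) (a C j) ⟩
      a C j + a C suc j                        ≡⟨ pascal a j ⟨
      suc a C suc j                            ∎
      where open ≋-Reasoning

    [a*p]C[j*p+r]≋0 : ∀ a j {r} → 0 < r → r < p → (a * p) C (j * p + r) ≋ 0
    [a*p]C[j*p+r]≋0 zero    j       {r} 0<r r<p = ≡⇒≋ (k>n⇒nCk≡0 (≤-trans 0<r (m≤n+m r (j * p))))
    [a*p]C[j*p+r]≋0 (suc a) zero    {r} 0<r r<p =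
      ≋-trans ([p+n]Ck≋nCk (a * p) r<p) ([a*p]C[j*p+r]≋0 a zero 0<r r<p)
    [a*p]C[j*p+r]≋0 (suc a) (suc j) {r} 0<r r<p = begin
      (p + a * p) C (p + j * p + r)                   ≡⟨ cong ((p + a * p) C_) (+-assoc p (j * p) r) ⟩
      (p + a * p) C (p + (j * p + r))                 ≈⟨ [p+n]C[p+k]≋nC[p+k]+nCk (a * p) (j * p + r) ⟩
      (a * p) C (p + (j * p + r)) + (a * p) C (j * p + r)
        ≡⟨ cong (λ x → (a * p) C x + (a * p) C (j * p + r)) (+-assoc p (j * p) r) ⟨
      (a * p) C (suc j * p + r) + (a * p) C (j * p + r)
        ≈⟨ +-cong-≋ ([a*p]C[j*p+r]≋0 a (suc j) 0<r r<p) ([a*p]C[j*p+r]≋0 a j 0<r r<p) ⟩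
      0                                               ∎
      where open ≋-Reasoning

    [a*p^d]C[j*p^d]≋aCj : ∀ d a j → (a * p ^ d) C (j * p ^ d) ≋ a C j
    [a*p^d]C[j*p^d]≋aCj zero    a j = ≡⇒≋ (cong₂ _C_ (*-identityʳ a) (*-identityʳ j))
    [a*p^d]C[j*p^d]≋aCj (suc d) a j = begin
      (a * (p * p ^ d)) C (j * (p * p ^ d))   ≡⟨ cong₂ _C_ (*-assoc a p (p ^ d)) (*-assoc j p (p ^ d)) ⟨
      (a * p * p ^ d) C (j * p * p ^ d)       ≈⟨ [a*p^d]C[j*p^d]≋aCj d (a * p) (j * p) ⟩
      (a * p) C (j * p)                       ≈⟨ [a*p]C[j*p]≋aCj a j ⟩
      a C j                                   ∎
      where open ≋-Reasoning

    -- Writing r = r₀ + r₁ p ^ d, either r₀ ≠ 0 and induction applies, or r₀ = 0 and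
    -- the previous lemma reduces to the case d = 1.
    [a*p^d]C[j*p^d+r]≋0 : ∀ d a j {r} → 0 < r → r < p ^ d → (a * p ^ d) C (j * p ^ d + r) ≋ 0
    [a*p^d]C[j*p^d+r]≋0 zero    a j {suc _} _   (s≤s ())
    [a*p^d]C[j*p^d+r]≋0 (suc d) a j {r} 0<r r<pq =
      split (r % q) (r / q) (m≡m%n+[m/n]*n r q) (m%n<n r q) (m<n*o⇒m/o<n r<pq)
      where
      q : ℕ
      q = p ^ d
      instance
        q≢0 : NonZero q
        q≢0 = m^n≢0 p d
      reindex : ∀ j p q r₀ r₁ → j * (p * q) + (r₀ + r₁ * q) ≡ (j * p + r₁) * q + r₀
      reindex = solve-∀
      split : ∀ r₀ r₁ → r ≡ r₀ + r₁ * q → r₀ < q → r₁ < p → (a * (p * q)) C (j * (p * q) + r) ≋ 0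
      split r₀ r₁ r≡ r₀<q r₁<p = begin
        (a * (p * q)) C (j * (p * q) + r)
          ≡⟨ cong₂ _C_ (sym (*-assoc a p q)) (trans (cong (j * (p * q) +_) r≡) (reindex j p q r₀ r₁)) ⟩
        (a * p * q) C ((j * p + r₁) * q + r₀)
          ≈⟨ low-digit r₀ refl r₀<q ⟩
        0
          ∎
        where
        open ≋-Reasoning
        low-digit : ∀ s → s ≡ r₀ → s < q → (a * p * q) C ((j * p + r₁) * q + s) ≋ 0
        low-digit zero    0≡r₀ _ = begin
          (a * p * q) C ((j * p + r₁) * q + 0)  ≡⟨ cong ((a * p * q) C_) (+-identityʳ ((j * p + r₁) * q)) ⟩
          (a * p * q) C ((j * p + r₁) * q)      ≈⟨ [a*p^d]C[j*p^d]≋aCj d (a * p) (j * p + r₁) ⟩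
          (a * p) C (j * p + r₁)                ≈⟨ [a*p]C[j*p+r]≋0 a j 0<r₁ r₁<p ⟩
          0                                     ∎
          where
          positive : ∀ x → r ≡ 0 + x * q → 0 < x
          positive zero    r≡0 = ⊥-elim (<⇒≢ 0<r (sym r≡0))
          positive (suc _) _   = z<s
          0<r₁ : 0 < r₁
          0<r₁ = positive r₁ (subst (λ s → r ≡ s + r₁ * q) (sym 0≡r₀) r≡)
        low-digit (suc s) _ s<q = [a*p^d]C[j*p^d+r]≋0 d (a * p) (j * p + r₁) z<s s<q

  record LucasModulus (q : ℕ) : Set where
    field
      C-on-grid  : ∀ a j → (a * q) C (j * q) ≋ a C j
      C-off-grid : ∀ a j {r} → 0 < r → r < q → (a * q) C (j * q + r) ≋ 0

  prime-power-LucasModulus : Prime p → ∀ d → LucasModulus (p ^ d)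
  prime-power-LucasModulus p-prime d = record
    { C-on-grid  = [a*p^d]C[j*p^d]≋aCj p-prime d
    ; C-off-grid = [a*p^d]C[j*p^d+r]≋0 p-prime d
    }

  ∑⊆-cong-≋ : ∀ {f g : List Bool → ℕ} → (∀ x → f x ≋ g x) → ∀ b → ∑⊆ f b ≋ ∑⊆ g b
  ∑⊆-cong-≋ f≋g []          = f≋g []
  ∑⊆-cong-≋ f≋g (false ∷ b) = ∑⊆-cong-≋ (f≋g ∘ (false ∷_)) b
  ∑⊆-cong-≋ f≋g (true ∷ b)  = +-cong-≋ (∑⊆-cong-≋ (f≋g ∘ (false ∷_)) b) (∑⊆-cong-≋ (f≋g ∘ (true ∷_)) b)

  -- Möbius inversion: ∑⊆ is unitriangular, so it is injective even modulo p.
  ∑⊆-injective-≋ : ∀ L (f g : List Bool → ℕ) → (∀ b → length b ≡ L → ∑⊆ f b ≋ ∑⊆ g b) →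
                   ∀ b → length b ≡ L → f b ≋ g b
  ∑⊆-injective-≋ zero    f g ∑f≋∑g []          _ = ∑f≋∑g [] refl
  ∑⊆-injective-≋ (suc L) f g ∑f≋∑g (false ∷ b) e =
    ∑⊆-injective-≋ L (f ∘ (false ∷_)) (g ∘ (false ∷_))
      (λ b′ e′ → ∑f≋∑g (false ∷ b′) (cong suc e′)) b (suc-injective e)
  ∑⊆-injective-≋ (suc L) f g ∑f≋∑g (true ∷ b)  e =
    ∑⊆-injective-≋ L (f ∘ (true ∷_)) (g ∘ (true ∷_))
      (λ b′ e′ → +-cancelˡ-≋ (∑f≋∑g (false ∷ b′) (cong suc e′)) (∑f≋∑g (true ∷ b′) (cong suc e′)))
      b (suc-injective e)

  sign : Bool → ℕ
  sign false = 1
  sign true  = p-1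

  sign-not : ∀ π y → sign (not π) * y ≋ p-1 * (sign π * y)
  sign-not false y = ≡⇒≋ (cong (p-1 *_) (sym (+-identityʳ y)))
  sign-not true  y = begin
    1 * y                ≈⟨ *-cong-≋ p-1*p-1≋1 (≋-refl {y}) ⟨
    p-1 * p-1 * y        ≡⟨ *-assoc p-1 p-1 y ⟩
    p-1 * (p-1 * y)      ∎
    where open ≋-Reasoning

  module GridCongruences (q-1 : ℕ) where
    open Grid q-1

    ∑⊆-signed-gridBits : ∀ b t (φ : List Bool → ℕ) →
      ∑⊆ (λ x → sign (offGridParity t x) * φ (gridBits t x)) b ≋ (if offGridClear t b then ∑⊆ φ (gridBits t b) else 0)
    ∑⊆-signed-gridBits []          t       φ = ≡⇒≋ (+-identityʳ (φ []))
    ∑⊆-signed-gridBits (false ∷ b) zero    φ = ∑⊆-signed-gridBits b q-1 (φ ∘ (false ∷_))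
    ∑⊆-signed-gridBits (true ∷ b)  zero    φ
      with ∑⊆-signed-gridBits b q-1 (φ ∘ (false ∷_)) | ∑⊆-signed-gridBits b q-1 (φ ∘ (true ∷_))
    ... | IH₀ | IH₁ with offGridClear q-1 b
    ...   | true  = +-cong-≋ IH₀ IH₁
    ...   | false = +-cong-≋ IH₀ IH₁
    ∑⊆-signed-gridBits (false ∷ b) (suc t) φ = ∑⊆-signed-gridBits b t φ
    ∑⊆-signed-gridBits (true ∷ b)  (suc t) φ = begin
      ∑⊆ f b + ∑⊆ (λ x → sign (not (offGridParity t x)) * φ (gridBits t x)) b
        ≈⟨ +-cong-≋ (≋-refl {∑⊆ f b}) (∑⊆-cong-≋ (λ x → sign-not (offGridParity t x) (φ (gridBits t x))) b) ⟩
      ∑⊆ f b + ∑⊆ (λ x → p-1 * f x) b   ≡⟨ cong (∑⊆ f b +_) (∑⊆-*ˡ p-1 f b) ⟩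
      ∑⊆ f b + p-1 * ∑⊆ f b             ≡⟨ *-comm p (∑⊆ f b) ⟩
      ∑⊆ f b * p                        ≈⟨ m*p≋0 (∑⊆ f b) ⟩
      0                                 ∎
      where
      open ≋-Reasoning
      f : List Bool → ℕ
      f x = sign (offGridParity t x) * φ (gridBits t x)

    module _ (lucas : LucasModulus q) where
      open LucasModulus lucas

      -- The first block of blocks k b has k elements so far and reaches the next grid
      -- position after t more bits, where its size would be (j + 1) q.
      multinomial-blocks≋ : ∀ b t k j r → t ≤ q-1 → k + t ≡ suc j * q → length b ≡ t + r * q →
        multinomial (blocks k b) ≋ (if offGridClear t b then multinomial (blocks (suc j) (gridBits t b)) else 0)
      multinomial-blocks≋ []          zero    k j zero    _ _ _ =
        ≡⇒≋ (trans (multinomial-[n] k) (sym (multinomial-[n] (suc j))))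
      multinomial-blocks≋ (false ∷ b) zero    k j (suc r) _ k≡ l =
        multinomial-blocks≋ b q-1 (suc k) (suc j) r ≤-refl (grid-step k (suc j * q) q-1 k≡) (suc-injective l)
        where
        grid-step : ∀ k x q-1 → k + 0 ≡ x → suc k + q-1 ≡ suc q-1 + x
        grid-step k x q-1 refl = cong suc (trans (+-comm k q-1) (cong (q-1 +_) (sym (+-identityʳ k))))
      multinomial-blocks≋ (true ∷ b)  zero    k j (suc r) _ k≡ l =
        ≋-trans (*-cong-≋ (≋-refl {binomial})
                          (multinomial-blocks≋ b q-1 1 0 r ≤-refl (sym (+-identityʳ q)) (suc-injective l)))
                (close (offGridClear q-1 b))
        where
        binomial : ℕ
        binomial = (k + sum (blocks 1 b)) C k
        grid-b : List Bool
        grid-b = gridBits q-1 b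
        binomial≋ : binomial ≋ (suc j + sum (blocks 1 grid-b)) C suc j
        binomial≋ = begin
          (k + sum (blocks 1 b)) C k
            ≡⟨ cong₂ _C_ (cong₂ _+_ k≡′ (trans (sum-blocks 1 b) (cong suc (suc-injective l)))) k≡′ ⟩
          (suc j * q + suc r * q) C (suc j * q)
            ≡⟨ cong (_C (suc j * q)) (*-distribʳ-+ q (suc j) (suc r)) ⟨
          ((suc j + suc r) * q) C (suc j * q)
            ≈⟨ C-on-grid (suc j + suc r) (suc j) ⟩
          (suc j + suc r) C suc j
            ≡⟨ cong (λ z → (suc j + z) C suc j)
                    (sym (trans (sum-blocks 1 grid-b) (cong suc (length-gridBits b q-1 r (suc-injective l))))) ⟩
          (suc j + sum (blocks 1 grid-b)) C suc j
            ∎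
          where
          open ≋-Reasoning
          k≡′ : k ≡ suc j * q
          k≡′ = trans (sym (+-identityʳ k)) k≡
        close : ∀ x → binomial * (if x then multinomial (blocks 1 grid-b) else 0)
                      ≋ (if x then multinomial (suc j ∷ blocks 1 grid-b) else 0)
        close false = ≡⇒≋ (*-zeroʳ binomial)
        close true  = *-cong-≋ binomial≋ ≋-refl
      multinomial-blocks≋ (false ∷ b) (suc t) k j r t<q-1 k≡ l =
        multinomial-blocks≋ b t (suc k) j r (≤-trans (n≤1+n t) t<q-1) (trans (sym (+-suc k t)) k≡) (suc-injective l)
      multinomial-blocks≋ (true ∷ b)  (suc t) k j r t<q-1 k≡ l with m≤n⇒∃[o]m+o≡n t<q-1
      ... | e , 1+t+e≡q-1 = ≋-trans (*-cong-≋ binomial≋0 (≋-refl {multinomial (blocks 1 b)})) ≋-refl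
        where
        reassoc : ∀ k t r j q → k + suc t ≡ suc j * q → k + suc (t + r * q) ≡ (suc j + r) * q
        reassoc k t r j q k≡ = trans (sym (+-assoc k (suc t) (r * q)))
                                     (trans (cong (_+ r * q) k≡) (sym (*-distribʳ-+ q (suc j) r)))
        shift : ∀ j t e → suc j * suc (suc t + e) ≡ j * suc (suc t + e) + suc e + suc t
        shift = solve-∀
        k≡jq+r : k ≡ j * q + suc e
        k≡jq+r = +-cancelʳ-≡ (suc t) k (j * q + suc e)
                   (trans k≡ (subst (λ z → suc j * suc z ≡ j * suc z + suc e + suc t) 1+t+e≡q-1 (shift j t e)))
        binomial≋0 : (k + sum (blocks 1 b)) C k ≋ 0
        binomial≋0 = ≋-trans (≡⇒≋ (cong₂ _C_ (trans (cong (k +_) (trans (sum-blocks 1 b) l)) (reassoc k t r j q k≡)) k≡jq+r))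
                             (C-off-grid (suc j + r) j z<s (s≤s (≤-trans (s≤s (m≤n+m e t)) (≤-reflexive 1+t+e≡q-1))))

      countExactly≋signed-gridBits : ∀ r b → length b ≡ q-1 + r * q →
        countExactly (q-1 + r * q) b ≋ sign (offGridParity q-1 b) * countExactly r (gridBits q-1 b)
      countExactly≋signed-gridBits r = ∑⊆-injective-≋ L _ _ ∑⊆-agree
        where
        L : ℕ
        L = q-1 + r * q
        grid-part : ∀ b → length b ≡ L → ∀ x → (if x then ∑⊆ (countExactly r) (gridBits q-1 b) else 0)
                                              ≡ (if x then blockMultinomial (gridBits q-1 b) else 0)
        grid-part b l false = refl
        grid-part b l true  = trans (sym (countWithin≡∑⊆countExactly r (gridBits q-1 b) (length-gridBits b q-1 r l)))
                                    (countWithin≡blockMultinomial r (gridBits q-1 b) (length-gridBits b q-1 r l))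
        ∑⊆-agree : ∀ b → length b ≡ L →
          ∑⊆ (countExactly L) b ≋ ∑⊆ (λ x → sign (offGridParity q-1 x) * countExactly r (gridBits q-1 x)) b
        ∑⊆-agree b l = begin
          ∑⊆ (countExactly L) b
            ≡⟨ countWithin≡∑⊆countExactly L b l ⟨
          countWithin L b
            ≡⟨ countWithin≡blockMultinomial L b l ⟩
          blockMultinomial b
            ≈⟨ multinomial-blocks≋ b q-1 1 0 r ≤-refl (sym (+-identityʳ q)) l ⟩
          (if offGridClear q-1 b then blockMultinomial (gridBits q-1 b) else 0)
            ≡⟨ grid-part b l (offGridClear q-1 b) ⟨
          (if offGridClear q-1 b then ∑⊆ (countExactly r) (gridBits q-1 b) else 0)
            ≈⟨ ∑⊆-signed-gridBits b q-1 (countExactly r) ⟨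
          ∑⊆ (λ x → sign (offGridParity q-1 x) * countExactly r (gridBits q-1 x)) b
            ∎
          where open ≋-Reasoning

      2*#ribbons : 1 ≤ q-1 → ∀ {P : ℕ → Set} (P? : (x : ℕ) → Dec (P x)) →
        (∀ {x y} → x ≋ y → does (P? x) ≡ does (P? y)) → ∀ r →
        2 * #ribbons P? (suc r * q) ≡ 2 ^ (q-1 + r * q-1) * (#ribbons P? (suc r) + #ribbons (P? ∘ (p-1 *_)) (suc r))
      2*#ribbons 1≤q-1 P? P-resp-≋ r = begin
        2 * #ribbons P? (suc L)
          ≡⟨ cong (2 *_) (#ribbons≡∑-allBits P? L) ⟩
        2 * ∑ (λ b → 𝟙 (does (P? (countExactly L b)))) (allBits L)
          ≡⟨ cong (2 *_) (∑-cong-All (All.map (cong 𝟙 ∘ P-resp-≋ ∘ countExactly≋signed-gridBits r _) (allBits-length L))) ⟩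
        2 * gridSum F q-1 L
          ≡⟨ 2*gridSum 1≤q-1 F r ⟩
        2 ^ (q-1 + r * q-1) * ∑ (λ c → F c false + F c true) (allBits r)
          ≡⟨ cong (2 ^ (q-1 + r * q-1) *_) (∑-+ (λ c → F c false) (λ c → F c true) (allBits r)) ⟩
        2 ^ (q-1 + r * q-1) * (∑ (λ c → F c false) (allBits r) + ∑ (λ c → F c true) (allBits r))
          ≡⟨ cong (λ z → 2 ^ (q-1 + r * q-1) * (z + ∑ (λ c → F c true) (allBits r)))
                  (∑-cong (allBits r) (λ c → cong (𝟙 ∘ does ∘ P?) (*-identityˡ (countExactly r c)))) ⟩
        2 ^ (q-1 + r * q-1) * (∑ (λ c → 𝟙 (does (P? (countExactly r c)))) (allBits r) + ∑ (λ c → F c true) (allBits r))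
          ≡⟨ cong₂ (λ x y → 2 ^ (q-1 + r * q-1) * (x + y))
                   (#ribbons≡∑-allBits P? r) (#ribbons≡∑-allBits (P? ∘ (p-1 *_)) r) ⟨
        2 ^ (q-1 + r * q-1) * (#ribbons P? (suc r) + #ribbons (P? ∘ (p-1 *_)) (suc r))
          ∎
        where
        open ≡-Reasoning
        L : ℕ
        L = q-1 + r * q
        F : List Bool → Bool → ℕ
        F c π = 𝟙 (does (P? (sign π * countExactly r c)))

  -1*x≡i⇔x≡-i : ∀ {i} x → i < p → (p-1 * x) % p ≡ i ⇔ x % p ≡ (p ∸ i) % p
  -1*x≡i⇔x≡-i {i} x i<p = mk⇔
    (λ e → ≋⇒%≡ (+-cancelˡ-≋ {p-1 * x} {i} {x} {p ∸ i} (mk≋ (trans e (sym (m<n⇒m%n≡m i<p)))) (begin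
      p-1 * x + x      ≡⟨ +-comm (p-1 * x) x ⟩
      p * x            ≡⟨ *-comm p x ⟩
      x * p            ≈⟨ m*p≋0 x ⟩
      0                ≈⟨ p≋0 ⟨
      p                ≡⟨ m+[n∸m]≡n (<⇒≤ i<p) ⟨
      i + (p ∸ i)      ∎)))
    (λ e → trans (≋⇒%≡ (≋-trans (*-cong-≋ (≋-refl {p-1}) (mk≋ e)) -1*[-i]≋i)) (m<n⇒m%n≡m i<p))
    where
    open ≋-Reasoning
    -1*[-i]≋i : p-1 * (p ∸ i) ≋ i
    -1*[-i]≋i = +-cancelˡ-≋ (≋-refl {p-1 * i}) (begin
      p-1 * i + p-1 * (p ∸ i)   ≡⟨ *-distribˡ-+ p-1 i (p ∸ i) ⟨
      p-1 * (i + (p ∸ i))       ≡⟨ cong (p-1 *_) (m+[n∸m]≡n (<⇒≤ i<p)) ⟩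
      p-1 * p                   ≈⟨ m*p≋0 p-1 ⟩
      0                         ≈⟨ m*p≋0 i ⟨
      i * p                     ≡⟨ *-comm i p ⟩
      i + p-1 * i               ≡⟨ +-comm i (p-1 * i) ⟩
      p-1 * i + i               ∎)

  i≡-i⇒p≡2 : Prime p → ∀ {i x} → 0 < i → i < p → x % p ≡ i → x % p ≡ (p ∸ i) % p → p ≡ 2
  i≡-i⇒p≡2 p-prime {i} 0<i i<p x≡i x≡-i
    with euclidsLemma 2 i p-prime (m%n≡0⇒n∣m (2 * i) p (≋⇒%≡ 2i≋0))
    where
    2i≋0 : 2 * i ≋ 0
    2i≋0 = begin
      2 * i          ≡⟨ cong (i +_) (+-identityʳ i) ⟩
      i + i          ≈⟨ +-cong-≋ (≋-refl {i}) (mk≋ {i} {p ∸ i} (trans (m<n⇒m%n≡m i<p) (trans (sym x≡i) x≡-i))) ⟩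
      i + (p ∸ i)    ≡⟨ m+[n∸m]≡n (<⇒≤ i<p) ⟩
      p              ≈⟨ p≋0 ⟩
      0              ∎
      where open ≋-Reasoning
  ... | inj₁ p∣2 = ≤-antisym (∣⇒≤ p∣2) (nonTrivial⇒n>1 p {{prime⇒nonTrivial p-prime}})
  ... | inj₂ p∣i = ⊥-elim (<⇒≱ i<p (∣⇒≤ {{>-nonZero 0<i}} p∣i))

  module Residues (p-prime : Prime p) {i : ℕ} (i<p : i < p) where

    #opposite : ℕ → ℕ
    #opposite m = #ribbons (λ x → (p-1 * x) % p ≟ i) m

    1<p^[1+d] : ∀ d → 1 < p ^ suc d
    1<p^[1+d] d = ≤-trans (nonTrivial⇒n>1 p {{prime⇒nonTrivial p-prime}}) (m≤m*n p (p ^ d) {{m^n≢0 p d}})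

    2*c≡ : ∀ d r → 2 * c p i (suc r * p ^ suc d) ≡ 2 ^ (suc r * p ^ suc d ∸ suc r) * (c p i (suc r) + #opposite (suc r))
    2*c≡ d r = subst (λ q → 2 * c p i (suc r * q) ≡ 2 ^ (suc r * q ∸ suc r) * (c p i (suc r) + #opposite (suc r)))
                     (suc-pred q)
                     (trans (GridCongruences.2*#ribbons (pred q) lucas 1≤q-1 (λ x → x % p ≟ i) %-resp-≋ r)
                            (cong (λ e → 2 ^ e * (c p i (suc r) + #opposite (suc r))) (exponent r (pred q))))
      where
      q : ℕ
      q = p ^ suc d
      instance
        q≢0 : NonZero q
        q≢0 = m^n≢0 p (suc d)
      lucas : LucasModulus (suc (pred q))
      lucas = subst LucasModulus (sym (suc-pred q)) (prime-power-LucasModulus p-prime (suc d))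
      1≤q-1 : 1 ≤ pred q
      1≤q-1 = ≤-pred (subst (1 <_) (sym (suc-pred q)) (1<p^[1+d] d))
      %-resp-≋ : ∀ {x y} → x ≋ y → does (x % p ≟ i) ≡ does (y % p ≟ i)
      %-resp-≋ x≋y = cong (λ z → does (z ≟ i)) (≋⇒%≡ x≋y)
      exponent : ∀ r q-1 → q-1 + r * q-1 ≡ suc r * suc q-1 ∸ suc r
      exponent r q-1 = sym (trans (cong (_∸ suc r) (expand r q-1)) (m+n∸m≡n (suc r) (q-1 + r * q-1)))
        where
        expand : ∀ r q-1 → suc r * suc q-1 ≡ suc r + (q-1 + r * q-1)
        expand = solve-∀

    opposite⇔ : i ≡ 0 ⊎ p ≡ 2 → ∀ y → (p-1 * y) % p ≡ i ⇔ y % p ≡ i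
    opposite⇔ (inj₁ refl) y = mk⇔ (λ e → trans (Equivalence.to (-1*x≡i⇔x≡-i y z<s) e) (n%n≡0 p))
                                  (λ e → Equivalence.from (-1*x≡i⇔x≡-i y z<s) (trans e (sym (n%n≡0 p))))
    opposite⇔ (inj₂ refl)   y = mk⇔ (trans (cong (_% p) (sym (+-identityʳ y)))) (trans (cong (_% p) (+-identityʳ y)))

    #opposite≡c : i ≡ 0 ⊎ p ≡ 2 → ∀ m → #opposite m ≡ c p i m
    #opposite≡c i≡0⊎p≡2 m = cong length (filter-≐ _ _
      ( (λ {γ} → Equivalence.to (opposite⇔ i≡0⊎p≡2 (ribbon γ)))
      , (λ {γ} → Equivalence.from (opposite⇔ i≡0⊎p≡2 (ribbon γ))) ) (compositions m))

    c+#opposite≡cPM : i ≢ 0 → p ≢ 2 → ∀ m → c p i m + #opposite m ≡ cPM p i m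
    c+#opposite≡cPM i≢0 p≢2 m = trans
      (cong (c p i m +_) (cong length (filter-≐ _ _
        ( (λ {γ} → Equivalence.to (-1*x≡i⇔x≡-i (ribbon γ) i<p))
        , (λ {γ} → Equivalence.from (-1*x≡i⇔x≡-i (ribbon γ) i<p)) ) (compositions m))))
      (length-filter-⊎ (λ γ → ribbon γ % p ≟ i) (λ γ → ribbon γ % p ≟ (p ∸ i) % p)
                       (λ {γ} x≡i x≡-i → p≢2 (i≡-i⇒p≡2 p-prime {x = ribbon γ} (n≢0⇒n>0 i≢0) i<p x≡i x≡-i))
                       (compositions m))

    c-symmetric : i ≡ 0 ⊎ p ≡ 2 → ∀ d r →
      c p i (suc r * p ^ suc d) ≡ 2 ^ (suc r * p ^ suc d ∸ suc r) * c p i (suc r)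
    c-symmetric i≡0⊎p≡2 d r = *-cancelˡ-≡ _ _ 2 (begin
      2 * c p i (suc r * p ^ suc d)          ≡⟨ 2*c≡ d r ⟩
      2 ^ e * (c p i (suc r) + #opposite (suc r))
        ≡⟨ cong (λ z → 2 ^ e * (c p i (suc r) + z)) (#opposite≡c i≡0⊎p≡2 (suc r)) ⟩
      2 ^ e * (c p i (suc r) + c p i (suc r)) ≡⟨ double (2 ^ e) (c p i (suc r)) ⟩
      2 * (2 ^ e * c p i (suc r))            ∎)
      where
      open ≡-Reasoning
      e : ℕ
      e = suc r * p ^ suc d ∸ suc r
      double : ∀ a x → a * (x + x) ≡ 2 * (a * x)
      double = solve-∀

    c-asymmetric : i ≢ 0 → p ≢ 2 → ∀ d r →
      c p i (suc r * p ^ suc d) ≡ 2 ^ (suc r * p ^ suc d ∸ suc r ∸ 1) * cPM p i (suc r)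
    c-asymmetric i≢0 p≢2 d r = *-cancelˡ-≡ _ _ 2 (begin
      2 * c p i (suc r * p ^ suc d)                 ≡⟨ 2*c≡ d r ⟩
      2 ^ e * (c p i (suc r) + #opposite (suc r))   ≡⟨ cong (2 ^ e *_) (c+#opposite≡cPM i≢0 p≢2 (suc r)) ⟩
      2 ^ e * cPM p i (suc r)                       ≡⟨ cong (λ z → 2 ^ z * cPM p i (suc r)) (m+[n∸m]≡n 1≤e) ⟨
      2 ^ (1 + (e ∸ 1)) * cPM p i (suc r)           ≡⟨ *-assoc 2 (2 ^ (e ∸ 1)) (cPM p i (suc r)) ⟩
      2 * (2 ^ (e ∸ 1) * cPM p i (suc r))           ∎)
      where
      open ≡-Reasoning
      e : ℕ
      e = suc r * p ^ suc d ∸ suc r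
      1≤e : 1 ≤ e
      1≤e = m<n⇒0<n∸m (m<m*n (suc r) (p ^ suc d) (1<p^[1+d] d))

c-d≡0 : ∀ p .{{_ : NonZero p}} i m → c p i (m * p ^ 0) ≡ 2 ^ (m * p ^ 0 ∸ m) * c p i m
c-d≡0 p i m rewrite *-identityʳ m | n∸n≡0 m = sym (+-identityʳ (c p i m))

corollary3p3 : (p : ℕ) .{{_ : NonZero p}} → Prime p →
    (m : ℕ) → 1 ≤ m → m < p → (d : ℕ) → (i : ℕ) → i < p →
      ((i ≡ 0 ⊎ p ≡ 2 ⊎ d ≡ 0) →
         c p i (m * p ^ d) ≡ 2 ^ (m * p ^ d ∸ m) * c p i m)
      × (¬ (i ≡ 0 ⊎ p ≡ 2 ⊎ d ≡ 0) →
         c p i (m * p ^ d) ≡ 2 ^ (m * p ^ d ∸ m ∸ 1) * cPM p i m)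
corollary3p3 (suc p-1) p-prime (suc r) _ _ zero    i i<p =
  (λ _ → c-d≡0 (suc p-1) i (suc r)) , (λ ¬d≡0 → ⊥-elim (¬d≡0 (inj₂ (inj₂ refl))))
corollary3p3 (suc p-1) p-prime (suc r) _ _ (suc d) i i<p = symmetric , asymmetric
  where
  open Modulo.Residues p-1 p-prime i<p
  n : ℕ
  n = suc r * suc p-1 ^ suc d
  symmetric : i ≡ 0 ⊎ suc p-1 ≡ 2 ⊎ suc d ≡ 0 → c (suc p-1) i n ≡ 2 ^ (n ∸ suc r) * c (suc p-1) i (suc r)
  symmetric (inj₁ i≡0)        = c-symmetric (inj₁ i≡0) d r
  symmetric (inj₂ (inj₁ p≡2)) = c-symmetric (inj₂ p≡2) d r
  symmetric (inj₂ (inj₂ ()))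
  asymmetric : ¬ (i ≡ 0 ⊎ suc p-1 ≡ 2 ⊎ suc d ≡ 0) → c (suc p-1) i n ≡ 2 ^ (n ∸ suc r ∸ 1) * cPM (suc p-1) i (suc r)
  asymmetric ¬symmetric = c-asymmetric (¬symmetric ∘ inj₁) (¬symmetric ∘ inj₂ ∘ inj₁) d r
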